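{- For $n\geq 6$, $F(C_n)<F(C_{3,3}^n)$ if and only if $n\leq 16$.
   Context: All graphs are finite, simple and undirected. $C_m$ is the cycle on $m$ vertices. For integers $m_1,m_2\geq 3$ and $n\geq m_1+m_2-1$, $C_{m_1,m_2}^n$ is the graph on $n$ vertices obtained as follows: if $n\geq m_1+m_2$, take a path on $n-(m_1+m_2)+2$ vertices and identify one end vertex of the path with a vertex of $C_{m_1}$ and the other end vertex with a vertex of $C_{m_2}$; if $n=m_1+m_2-1$, identify one vertex of $C_{m_1}$ with one vertex of $C_{m_2}$. A connected subgraph of a graph $G=(V,E)$ is a graph $(V',E')$ with $\emptyset\neq V'\subseteq V$, $E'\subseteq E$, every edge of $E'$ having both endpoints in $V'$, and $(V',E')$ connected; distinct pairs $(V',E')$ are counted separately. The core index $F(G)$ is the number of connected subgraphs of $G$. -}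

module Defs where

open import Data.Nat using (ℕ; zero; suc; _+_; _∸_; _<_; _≤_)
open import Data.Fin using (Fin; toℕ)
open import Data.Bool using (Bool; true; false)
open import Data.Vec using (Vec; lookup)
open import Data.List using (List; length)
open import Data.List.Membership.Propositional using (_∈_)
open import Data.List.Relation.Unary.Unique.Propositional using (Unique)
open import Data.Product using (Σ; _×_; ∃)
open import Data.Sum using (_⊎_)
open import Data.Empty using (⊥)
open import Function.Bundles using (_⇔_)
open import Relation.Binary.PropositionalEquality using (_≡_)

Graph : ℕ → Set₁
Graph n = Fin n → Fin n → Set

record IsSimple {n : ℕ} (G : Graph n) : Set where
  field
    sym    : ∀ i j → G i j → G j i
    irrefl : ∀ i → G i i → ⊥

SymOn : (n : ℕ) → (ℕ → ℕ → Set) → Graph n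
SymOn n E i j = E (toℕ i) (toℕ j) ⊎ E (toℕ j) (toℕ i)

CycleE : ℕ → ℕ → ℕ → Set
CycleE n a b = (b ≡ suc a × b < n) ⊎ (a ≡ 0 × b ≡ n ∸ 1)

Cycle : (n : ℕ) → Graph n
Cycle n = SymOn n (CycleE n)

-- C_{3,3}^n (n ≥ 5): triangle {0,1,2}, path 2,3,…,n-3, triangle {n-3,n-2,n-1}.
-- Edges: {i,i+1} for 0 ≤ i ≤ n-2, plus {0,2} and {n-3,n-1}.
C33E : ℕ → ℕ → ℕ → Set
C33E n a b = (b ≡ suc a × b < n) ⊎ (a ≡ 0 × b ≡ 2) ⊎ (a ≡ n ∸ 3 × b ≡ n ∸ 1)

C33 : (n : ℕ) → Graph n
C33 n = SymOn n (C33E n)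

-- A candidate subgraph (V', E'): V' a subset of vertices (characteristic vector),
-- E' a set of unordered pairs encoded by an upper-triangular 0/1 matrix
-- (entry (i,j) with toℕ i < toℕ j stands for the edge {i,j}).
SubgraphData : ℕ → Set
SubgraphData n = Vec Bool n × Vec (Vec Bool n) n

InE : {n : ℕ} → Vec (Vec Bool n) n → Fin n → Fin n → Set
InE M i j = lookup (lookup M i) j ≡ true

EdgeIn : {n : ℕ} → Vec (Vec Bool n) n → Fin n → Fin n → Set
EdgeIn M u v = InE M u v ⊎ InE M v u

data Reach {n : ℕ} (M : Vec (Vec Bool n) n) : Fin n → Fin n → Set where
  here : ∀ {u} → Reach M u u
  step : ∀ {u w v} → EdgeIn M u w → Reach M w v → Reach M u v

record IsConnSub {n : ℕ} (G : Graph n) (S : SubgraphData n) : Set where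
  constructor connSub
  V = Data.Product.proj₁ S
  M = Data.Product.proj₂ S
  field
    nonempty  : ∃ λ v → lookup V v ≡ true
    edges     : ∀ i j → InE M i j →
                  (toℕ i < toℕ j) × G i j × (lookup V i ≡ true) × (lookup V j ≡ true)
    connected : ∀ u v → lookup V u ≡ true → lookup V v ≡ true → Reach M u v

HasCount : {A : Set} → (A → Set) → ℕ → Set
HasCount {A} P k = Σ (List A) λ L → Unique L × length L ≡ k × (∀ x → (x ∈ L) ⇔ P x)

-- F(G) = k : the number of connected subgraphs of G is k.
CoreIndexIs : {n : ℕ} → Graph n → ℕ → Set
CoreIndexIs G k = HasCount (IsConnSub G) k

-- A connected subgraph with at least one edge is determined by its edge set (its vertices
-- are the endpoints), so F(G) = n + #(nonempty connected edge sets).  In C_n such a set is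
-- an arc of the path 0 – 1 – ⋯ – (n-1) (T(n-1) of them, T the triangular numbers), the
-- complement of such an arc (T(n-1)), or the whole cycle, so F(C_n) = n + n(n-1) + 1.
-- In C_{3,3}^n, with k = n - 5 path edges between the triangles, it is a nonempty edge set
-- of one triangle (7 + 7), an interval of the path (T(k)), or an interval reaching one or
-- both triangles together with, at each reached triangle, one of its 6 edge sets that meet
-- the path (6k + 6k + 36).  The difference of the two quadratics changes sign between
-- n = 16 and n = 17.
--
-- Connectedness of each listed edge set is witnessed by walks to a root vertex.  That the
-- list is complete is a cut argument: if a path edge is missing and no chord jumps over
-- it, no connected subgraph has vertices on both sides, so the present path edges form an
-- interval.

module Submission where

open import Defs
open import Data.Nat using (ℕ; zero; suc; _+_; _*_; _∸_; _<_; _≤_; s≤s; z≤n; _≡ᵇ_; _<ᵇ_; _≤ᵇ_; _<?_; _≤?_)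
open import Data.Nat.Properties
open import Data.Nat.Tactic.RingSolver using (solve-∀)
open import Data.Bool using (Bool; true; false; _∨_; _∧_; not)
open import Data.Bool.Properties as Bool using (T-≡; ∧-conicalˡ; ∧-conicalʳ; ∨-conicalˡ; ∨-conicalʳ; ∧-identityʳ; ∧-zeroʳ; ∨-identityʳ; not-involutive; not-injective)
open import Data.Unit using (⊤; tt)
open import Data.Empty using (⊥; ⊥-elim)
open import Data.Product using (Σ; _×_; _,_; proj₁; proj₂; ∃; uncurry)
import Data.Product.Properties as Product
open import Data.Sum using (_⊎_; inj₁; inj₂)
open import Data.Maybe using (Maybe; just; nothing)
open import Data.Fin using (Fin; toℕ; fromℕ<) renaming (zero to fzero; suc to fsuc)
open import Data.Fin.Properties using (toℕ-fromℕ<; toℕ-injective; toℕ<n)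
open import Data.Vec using (Vec; []; _∷_; lookup)
open import Data.List using (List; []; _∷_; length; map; _++_; filter)
open import Data.List.Properties using (length-++; length-map)
open import Data.List.Membership.Propositional using (_∈_)
open import Data.List.Membership.Propositional.Properties using (∈-map⁺; ∈-map⁻; ∈-++⁺ˡ; ∈-++⁺ʳ; ∈-++⁻; ∈-filter⁺; ∈-filter⁻)
open import Data.List.Relation.Unary.Any using (here; there)
open import Data.List.Relation.Unary.All as All using (All; []; _∷_)
open import Data.List.Relation.Unary.AllPairs using ([]; _∷_)
open import Data.List.Relation.Unary.Unique.Propositional using (Unique)
import Data.List.Relation.Unary.Unique.Propositional.Properties as Unique
open import Data.List.Relation.Unary.Unique.DecPropositional (Product.≡-dec Bool._≟_ (Product.≡-dec Bool._≟_ Bool._≟_)) using (unique?)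
open import Function using (_∘_)
open import Function.Bundles using (_⇔_; mk⇔; Equivalence)
open import Relation.Binary.Definitions using (tri<; tri≈; tri>)
open import Relation.Binary.PropositionalEquality
open import Relation.Nullary using (¬_; Dec; yes; no)
open import Relation.Nullary.Decidable using (toWitness)

-- Counting

map⁺-injectiveOn : {A B : Set} (f : A → B) (L : List A) → (∀ {x y} → x ∈ L → y ∈ L → f x ≡ f y → x ≡ y) →
  Unique L → Unique (map f L)
map⁺-injectiveOn f [] inj [] = []
map⁺-injectiveOn {A} f (x ∷ L) inj (x∉L ∷ u) =
  distinct L x∉L there ∷ map⁺-injectiveOn f L (λ p q → inj (there p) (there q)) u
  where
  distinct : (K : List A) → All (x ≢_) K → (∀ {y} → y ∈ K → y ∈ x ∷ L) → All (f x ≢_) (map f K)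
  distinct [] [] _ = []
  distinct (y ∷ K) (x≢y ∷ a) sub =
    (λ e → x≢y (inj (here refl) (sub (here refl)) e)) ∷ distinct K a (λ m → sub (there m))

module _ {A : Set} {P Q : A → Set} where

  HasCount-resp : ∀ {k} → (∀ x → P x → Q x) → (∀ x → Q x → P x) → HasCount P k → HasCount Q k
  HasCount-resp P⇒Q Q⇒P (L , u , len , iff) =
    L , u , len ,
    λ x → mk⇔ (λ m → P⇒Q x (Equivalence.to (iff x) m)) (λ q → Equivalence.from (iff x) (Q⇒P x q))

  HasCount-⊎ : ∀ {a b} → (∀ x → P x → Q x → ⊥) → HasCount P a → HasCount Q b →
    HasCount (λ x → P x ⊎ Q x) (a + b)
  HasCount-⊎ disjoint (L , u , len , iff) (K , v , len′ , iff′) =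
    L ++ K ,
    Unique.++⁺ u v (λ (m , m′) → disjoint _ (Equivalence.to (iff _) m) (Equivalence.to (iff′ _) m′)) ,
    trans (length-++ L) (cong₂ _+_ len len′) ,
    λ x → mk⇔ (λ m → Data.Sum.map (Equivalence.to (iff x)) (Equivalence.to (iff′ x)) (∈-++⁻ L m))
               (λ { (inj₁ p) → ∈-++⁺ˡ (Equivalence.from (iff x) p)
                  ; (inj₂ q) → ∈-++⁺ʳ L (Equivalence.from (iff′ x) q) })

HasCount-image : {A B : Set} {P : A → Set} {k : ℕ} (f : A → B) →
  (∀ {x y} → P x → P y → f x ≡ f y → x ≡ y) → HasCount P k → HasCount (λ b → Σ A λ a → P a × f a ≡ b) k
HasCount-image f inj (L , u , len , iff) =
  map f L ,
  map⁺-injectiveOn f L (λ p q → inj (Equivalence.to (iff _) p) (Equivalence.to (iff _) q)) u ,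
  trans (length-map f L) len ,
  λ b → mk⇔ (λ m → let (a , a∈ , e) = ∈-map⁻ f m in a , Equivalence.to (iff a) a∈ , sym e)
             (λ { (a , pa , refl) → ∈-map⁺ f (Equivalence.from (iff a) pa) })

HasCount-∅ : {A : Set} {P : A → Set} → (∀ x → ¬ P x) → HasCount P 0
HasCount-∅ none = [] , [] , refl , λ x → mk⇔ (λ ()) (λ p → ⊥-elim (none x p))

HasCount-singleton : {A : Set} (a : A) → HasCount (a ≡_) 1
HasCount-singleton a = a ∷ [] , [] ∷ [] , refl , λ x → mk⇔ (λ { (here refl) → refl }) (λ { refl → here refl })

HasCount-< : (m : ℕ) → HasCount (_< m) m
HasCount-< zero = HasCount-∅ (λ _ ())
HasCount-< (suc m) =
  HasCount-resp to from (subst (HasCount _) (+-comm m 1) (HasCount-⊎ disjoint (HasCount-< m) (HasCount-singleton m)))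
  where
  disjoint : ∀ x → x < m → m ≡ x → ⊥
  disjoint x x<m refl = <-irrefl refl x<m
  to : ∀ x → x < m ⊎ m ≡ x → x < suc m
  to x (inj₁ x<m) = m<n⇒m<1+n x<m
  to x (inj₂ refl) = ≤-refl
  from : ∀ x → x < suc m → x < m ⊎ m ≡ x
  from x (s≤s x≤m) = Data.Sum.map₂ sym (m≤n⇒m<n∨m≡n x≤m)

HasCount-× : {A B : Set} {P : A → Set} {Q : B → Set} {a b : ℕ} → HasCount P a → HasCount Q b →
  HasCount (λ (p : A × B) → P (proj₁ p) × Q (proj₂ p)) (a * b)
HasCount-× {A = A} {B} {Q = Q} {b = b} (L , u , len , iff) Qb =
  subst (HasCount _) (cong (_* b) len)
    (HasCount-resp (λ _ (m , q) → Equivalence.to (iff _) m , q) (λ _ (x , q) → Equivalence.from (iff _) x , q)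
                   (overList L u))
  where
  overList : (L : List A) → Unique L → HasCount (λ (p : A × B) → proj₁ p ∈ L × Q (proj₂ p)) (length L * b)
  overList [] [] = HasCount-∅ (λ _ ())
  overList (x ∷ L) (x∉L ∷ u) =
    HasCount-resp to from (HasCount-⊎ disjoint (HasCount-image (x ,_) (λ _ _ e → cong proj₂ e) Qb) (overList L u))
    where
    disjoint : ∀ p → Σ B (λ y → Q y × (x , y) ≡ p) → proj₁ p ∈ L × Q (proj₂ p) → ⊥
    disjoint _ (y , _ , refl) (m , _) = All.lookup x∉L m refl
    to : ∀ p → Σ B (λ y → Q y × (x , y) ≡ p) ⊎ (proj₁ p ∈ L × Q (proj₂ p)) →
      proj₁ p ∈ x ∷ L × Q (proj₂ p)
    to _ (inj₁ (y , q , refl)) = here refl , q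
    to _ (inj₂ (m , q)) = there m , q
    from : ∀ p → proj₁ p ∈ x ∷ L × Q (proj₂ p) →
      Σ B (λ y → Q y × (x , y) ≡ p) ⊎ (proj₁ p ∈ L × Q (proj₂ p))
    from (_ , y) (here refl , q) = inj₁ (y , q , refl)
    from _ (there m , q) = inj₂ (m , q)

triangle : ℕ → ℕ
triangle zero = zero
triangle (suc m) = triangle m + suc m

Interval : ℕ → ℕ × ℕ → Set
Interval m (s , e) = s ≤ e × e < m

HasCount-Interval : (m : ℕ) → HasCount (Interval m) (triangle m)
HasCount-Interval zero = HasCount-∅ (λ { (s , e) (_ , ()) })
HasCount-Interval (suc m) =
  HasCount-resp to from (HasCount-⊎ disjoint (HasCount-Interval m)
                                  (HasCount-image (_, m) (λ _ _ e → cong proj₁ e) (HasCount-< (suc m))))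
  where
  EndingAt-m : ℕ × ℕ → Set
  EndingAt-m p = Σ ℕ λ s → s < suc m × (s , m) ≡ p
  disjoint : ∀ p → Interval m p → EndingAt-m p → ⊥
  disjoint _ (_ , m<m) (s , _ , refl) = <-irrefl refl m<m
  to : ∀ p → Interval m p ⊎ EndingAt-m p → Interval (suc m) p
  to _ (inj₁ (s≤e , e<m)) = s≤e , m<n⇒m<1+n e<m
  to _ (inj₂ (s , s<1+m , refl)) = ≤-pred s<1+m , ≤-refl
  from : ∀ p → Interval (suc m) p → Interval m p ⊎ EndingAt-m p
  from (s , e) (s≤e , s≤s e≤m) with m≤n⇒m<n∨m≡n e≤m
  ... | inj₁ e<m = inj₁ (s≤e , e<m)
  ... | inj₂ refl = inj₂ (s , s≤s s≤e , refl)

HasCount-filter : {A : Set} (L : List A) → Unique L → (∀ x → x ∈ L) → (p : A → Bool) →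
  HasCount (λ x → p x ≡ true) (length (filter (λ x → p x Bool.≟ true) L))
HasCount-filter {A} L u every p =
  filter P? L , Unique.filter⁺ P? u , refl ,
  λ x → mk⇔ (λ m → proj₂ (∈-filter⁻ P? {xs = L} m)) (∈-filter⁺ P? (every x))
  where
  P? : (x : A) → Dec (p x ≡ true)
  P? x = p x Bool.≟ true

true≢false : true ≢ false
true≢false ()

true-or-false : (b : Bool) → b ≡ true ⊎ b ≡ false
true-or-false true = inj₁ refl
true-or-false false = inj₂ refl

≡true-ext : {x y : Bool} → (x ≡ true → y ≡ true) → (y ≡ true → x ≡ true) → x ≡ y
≡true-ext {true} {true} _ _ = refl
≡true-ext {true} {false} x⇒y _ = sym (x⇒y refl)
≡true-ext {false} {true} _ y⇒x = y⇒x refl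
≡true-ext {false} {false} _ _ = refl

∨≡true⇒⊎ : ∀ {x y} → x ∨ y ≡ true → x ≡ true ⊎ y ≡ true
∨≡true⇒⊎ {true} _ = inj₁ refl
∨≡true⇒⊎ {false} y≡true = inj₂ y≡true

∨≡trueˡ : ∀ {x} y → x ≡ true → x ∨ y ≡ true
∨≡trueˡ y refl = refl

∨≡trueʳ : ∀ x {y} → y ≡ true → x ∨ y ≡ true
∨≡trueʳ true _ = refl
∨≡trueʳ false y≡true = y≡true

∧≡true⇒× : ∀ {x y} → x ∧ y ≡ true → x ≡ true × y ≡ true
∧≡true⇒× {x} {y} e = ∧-conicalˡ x y e , ∧-conicalʳ x y e

×⇒∧≡true : ∀ {x y} → x ≡ true → y ≡ true → x ∧ y ≡ true
×⇒∧≡true refl y≡true = y≡true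

not≡true⇒≡false : ∀ {x} → not x ≡ true → x ≡ false
not≡true⇒≡false {false} _ = refl

≡ᵇ≡true⇒≡ : ∀ a b → (a ≡ᵇ b) ≡ true → a ≡ b
≡ᵇ≡true⇒≡ a b e = ≡ᵇ⇒≡ a b (Equivalence.from T-≡ e)

≡⇒≡ᵇ≡true : ∀ a b → a ≡ b → (a ≡ᵇ b) ≡ true
≡⇒≡ᵇ≡true a b e = Equivalence.to T-≡ (≡⇒≡ᵇ a b e)

≢⇒≡ᵇ≡false : ∀ a b → a ≢ b → (a ≡ᵇ b) ≡ false
≢⇒≡ᵇ≡false a b a≢b with a ≡ᵇ b in e
... | false = refl
... | true = ⊥-elim (a≢b (≡ᵇ≡true⇒≡ a b e))

≤⇒≤ᵇ≡true : ∀ {a b} → a ≤ b → (a ≤ᵇ b) ≡ true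
≤⇒≤ᵇ≡true a≤b = Equivalence.to T-≡ (≤⇒≤ᵇ a≤b)

≤ᵇ≡true⇒≤ : ∀ a b → (a ≤ᵇ b) ≡ true → a ≤ b
≤ᵇ≡true⇒≤ a b e = ≤ᵇ⇒≤ a b (Equivalence.from T-≡ e)

>⇒≤ᵇ≡false : ∀ a b → b < a → (a ≤ᵇ b) ≡ false
>⇒≤ᵇ≡false a b b<a with a ≤ᵇ b in e
... | false = refl
... | true = ⊥-elim (<⇒≱ b<a (≤ᵇ≡true⇒≤ a b e))

<⇒<ᵇ≡true : ∀ {a b} → a < b → (a <ᵇ b) ≡ true
<⇒<ᵇ≡true a<b = Equivalence.to T-≡ (<⇒<ᵇ a<b)

<ᵇ≡true⇒< : ∀ a b → (a <ᵇ b) ≡ true → a < b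
<ᵇ≡true⇒< a b e = <ᵇ⇒< a b (Equivalence.from T-≡ e)

≥⇒<ᵇ≡false : ∀ a b → b ≤ a → (a <ᵇ b) ≡ false
≥⇒<ᵇ≡false a b b≤a with a <ᵇ b in e
... | false = refl
... | true = ⊥-elim (<⇒≱ (<ᵇ≡true⇒< a b e) b≤a)

≤ᵇ-step : ∀ c a → a ≢ c → (a ≤ᵇ c) ≡ (suc a ≤ᵇ c)
≤ᵇ-step c a a≢c with <-cmp a c
... | tri< a<c _ _ = trans (≤⇒≤ᵇ≡true (<⇒≤ a<c)) (sym (≤⇒≤ᵇ≡true a<c))
... | tri≈ _ a≡c _ = ⊥-elim (a≢c a≡c)
... | tri> _ _ a>c = trans (>⇒≤ᵇ≡false a c a>c) (sym (>⇒≤ᵇ≡false (suc a) c (m<n⇒m<1+n a>c)))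

lookupℕ : {A : Set} {n : ℕ} → Vec A n → ℕ → A → A
lookupℕ [] k d = d
lookupℕ (x ∷ v) zero d = x
lookupℕ (x ∷ v) (suc k) d = lookupℕ v k d

lookup≡lookupℕ : {A : Set} {n : ℕ} (v : Vec A n) (i : Fin n) (d : A) → lookup v i ≡ lookupℕ v (toℕ i) d
lookup≡lookupℕ (x ∷ v) fzero d = refl
lookup≡lookupℕ (x ∷ v) (fsuc i) d = lookup≡lookupℕ v i d

lookupℕ-fromℕ< : {A : Set} {n : ℕ} (v : Vec A n) {k : ℕ} (k<n : k < n) (d : A) →
  lookup v (fromℕ< k<n) ≡ lookupℕ v k d
lookupℕ-fromℕ< v k<n d = trans (lookup≡lookupℕ v (fromℕ< k<n) d) (cong (λ k → lookupℕ v k d) (toℕ-fromℕ< k<n))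

lookupℕ-out : {A : Set} {n : ℕ} (v : Vec A n) (k : ℕ) (d : A) → n ≤ k → lookupℕ v k d ≡ d
lookupℕ-out [] k d _ = refl
lookupℕ-out (x ∷ v) (suc k) d (s≤s n≤k) = lookupℕ-out v k d n≤k

tabulateℕ : {A : Set} (n : ℕ) → (ℕ → A) → Vec A n
tabulateℕ zero f = []
tabulateℕ (suc n) f = f 0 ∷ tabulateℕ n (λ k → f (suc k))

lookupℕ-tabulateℕ : {A : Set} (n : ℕ) (f : ℕ → A) → ∀ k d → k < n → lookupℕ (tabulateℕ n f) k d ≡ f k
lookupℕ-tabulateℕ (suc n) f zero d _ = refl
lookupℕ-tabulateℕ (suc n) f (suc k) d (s≤s k<n) = lookupℕ-tabulateℕ n (λ k → f (suc k)) k d k<n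

lookup-tabulateℕ : {A : Set} (n : ℕ) (f : ℕ → A) (i : Fin n) → lookup (tabulateℕ n f) i ≡ f (toℕ i)
lookup-tabulateℕ n f i =
  trans (lookup≡lookupℕ (tabulateℕ n f) i (f 0)) (lookupℕ-tabulateℕ n f (toℕ i) (f 0) (toℕ<n i))

≡tabulateℕ : {A : Set} {n : ℕ} (v : Vec A n) (f : ℕ → A) (d : A) →
  (∀ k → k < n → lookupℕ v k d ≡ f k) → v ≡ tabulateℕ n f
≡tabulateℕ [] f d _ = refl
≡tabulateℕ (x ∷ v) f d h =
  cong₂ _∷_ (h 0 (s≤s z≤n)) (≡tabulateℕ v (λ k → f (suc k)) d (λ k k<n → h (suc k) (s≤s k<n)))

entry : {m n : ℕ} → Vec (Vec Bool n) m → ℕ → ℕ → Bool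
entry [] a b = false
entry (r ∷ M) zero b = lookupℕ r b false
entry (r ∷ M) (suc a) b = entry M a b

lookup²≡entry : {m n : ℕ} (M : Vec (Vec Bool n) m) (i : Fin m) (j : Fin n) →
  lookup (lookup M i) j ≡ entry M (toℕ i) (toℕ j)
lookup²≡entry (r ∷ M) fzero j = lookup≡lookupℕ r j false
lookup²≡entry (r ∷ M) (fsuc i) j = lookup²≡entry M i j

entry-outˡ : {m n : ℕ} (M : Vec (Vec Bool n) m) → ∀ a b → m ≤ a → entry M a b ≡ false
entry-outˡ [] a b _ = refl
entry-outˡ (r ∷ M) (suc a) b (s≤s m≤a) = entry-outˡ M a b m≤a

entry-outʳ : {m n : ℕ} (M : Vec (Vec Bool n) m) → ∀ a b → n ≤ b → entry M a b ≡ false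
entry-outʳ [] a b _ = refl
entry-outʳ (r ∷ M) zero b n≤b = lookupℕ-out r b false n≤b
entry-outʳ (r ∷ M) (suc a) b n≤b = entry-outʳ M a b n≤b

tabulateℕ² : (m n : ℕ) → (ℕ → ℕ → Bool) → Vec (Vec Bool n) m
tabulateℕ² zero n X = []
tabulateℕ² (suc m) n X = tabulateℕ n (X 0) ∷ tabulateℕ² m n (λ a → X (suc a))

entry-tabulateℕ² : (m n : ℕ) → ∀ X a b → a < m → b < n → entry (tabulateℕ² m n X) a b ≡ X a b
entry-tabulateℕ² (suc m) n X zero b _ b<n = lookupℕ-tabulateℕ n (X 0) b false b<n
entry-tabulateℕ² (suc m) n X (suc a) b (s≤s a<m) b<n = entry-tabulateℕ² m n (λ a → X (suc a)) a b a<m b<n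

lookup²-tabulateℕ² : (n : ℕ) (X : ℕ → ℕ → Bool) (i j : Fin n) →
  lookup (lookup (tabulateℕ² n n X) i) j ≡ X (toℕ i) (toℕ j)
lookup²-tabulateℕ² n X i j =
  trans (lookup²≡entry (tabulateℕ² n n X) i j) (entry-tabulateℕ² n n X (toℕ i) (toℕ j) (toℕ<n i) (toℕ<n j))

≡tabulateℕ² : {m n : ℕ} (M : Vec (Vec Bool n) m) (X : ℕ → ℕ → Bool) →
  (∀ a b → a < m → b < n → entry M a b ≡ X a b) → M ≡ tabulateℕ² m n X
≡tabulateℕ² [] X _ = refl
≡tabulateℕ² (r ∷ M) X h =
  cong₂ _∷_ (≡tabulateℕ r (X 0) false (λ b → h 0 b (s≤s z≤n)))
            (≡tabulateℕ² M (λ a → X (suc a)) (λ a b a<m → h (suc a) b (s≤s a<m)))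

anyBelow : ℕ → (ℕ → Bool) → Bool
anyBelow zero f = false
anyBelow (suc n) f = f n ∨ anyBelow n f

anyBelow-witness : ∀ n f → anyBelow n f ≡ true → Σ ℕ λ w → w < n × f w ≡ true
anyBelow-witness (suc n) f e with ∨≡true⇒⊎ {f n} e
... | inj₁ fn = n , ≤-refl , fn
... | inj₂ rest = let (w , w<n , fw) = anyBelow-witness n f rest in w , m<n⇒m<1+n w<n , fw

anyBelow-intro : ∀ n f w → w < n → f w ≡ true → anyBelow n f ≡ true
anyBelow-intro (suc n) f w (s≤s w≤n) fw with m≤n⇒m<n∨m≡n w≤n
... | inj₁ w<n = ∨≡trueʳ (f n) (anyBelow-intro n f w w<n fw)
... | inj₂ refl = ∨≡trueˡ (anyBelow n f) fw

anyBelow≡false⇒ : ∀ n f → anyBelow n f ≡ false → ∀ w → w < n → f w ≡ false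
anyBelow≡false⇒ n f e w w<n with f w in fw
... | false = refl
... | true = ⊥-elim (true≢false (trans (sym (anyBelow-intro n f w w<n fw)) e))

-- Intervals

inInterval : ℕ → ℕ → ℕ → Bool
inInterval s e k = (s ≤ᵇ k) ∧ (k ≤ᵇ e)

inInterval≡true : ∀ {s e k} → s ≤ k → k ≤ e → inInterval s e k ≡ true
inInterval≡true s≤k k≤e rewrite ≤⇒≤ᵇ≡true s≤k = ≤⇒≤ᵇ≡true k≤e

inInterval-below : ∀ s e k → k < s → inInterval s e k ≡ false
inInterval-below s e k k<s rewrite >⇒≤ᵇ≡false s k k<s = refl

inInterval-above : ∀ s e k → e < k → inInterval s e k ≡ false
inInterval-above s e k e<k with s ≤ᵇ k
... | false = refl
... | true = >⇒≤ᵇ≡false k e e<k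

inInterval≡true⇒ : ∀ s e k → inInterval s e k ≡ true → s ≤ k × k ≤ e
inInterval≡true⇒ s e k x =
  let (s≤ᵇk , k≤ᵇe) = ∧≡true⇒× {s ≤ᵇ k} x in ≤ᵇ≡true⇒≤ s k s≤ᵇk , ≤ᵇ≡true⇒≤ k e k≤ᵇe

inInterval-extend : ∀ s e k → k ≤ e → inInterval s e k ≡ inInterval s (suc e) k
inInterval-extend s e k k≤e with s ≤ᵇ k
... | false = refl
... | true = trans (≤⇒≤ᵇ≡true k≤e) (sym (≤⇒≤ᵇ≡true (m≤n⇒m≤1+n k≤e)))

inInterval-step : ∀ s e k → suc k ≢ s → k ≢ e → inInterval s e k ≡ inInterval s e (suc k)
inInterval-step s e k 1+k≢s k≢e = cong₂ _∧_ lower (≤ᵇ-step e k k≢e)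
  where
  lower : (s ≤ᵇ k) ≡ (s ≤ᵇ suc k)
  lower with <-cmp s (suc k)
  ... | tri< s<1+k _ _ = trans (≤⇒≤ᵇ≡true (m<1+n⇒m≤n s<1+k)) (sym (≤⇒≤ᵇ≡true (<⇒≤ s<1+k)))
  ... | tri≈ _ s≡1+k _ = ⊥-elim (1+k≢s (sym s≡1+k))
  ... | tri> _ _ s>1+k = trans (>⇒≤ᵇ≡false s k (<-trans ≤-refl s>1+k)) (sym (>⇒≤ᵇ≡false s (suc k) s>1+k))

NoGap : (ℕ → Bool) → ℕ → Set
NoGap f m = ∀ a c b → a < c → c < b → b < m → f a ≡ true → f c ≡ false → f b ≡ true → ⊥

IsIntervalIndicator : (ℕ → Bool) → ℕ → Set
IsIntervalIndicator f m =
  Σ (ℕ × ℕ) λ (s , e) → Interval m (s , e) × (∀ k → k < m → f k ≡ inInterval s e k)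

AllFalse : (ℕ → Bool) → ℕ → Set
AllFalse f m = ∀ k → k < m → f k ≡ false

noGap⇒allFalse⊎interval : ∀ m f → NoGap f m → AllFalse f m ⊎ IsIntervalIndicator f m
noGap⇒allFalse⊎interval zero f _ = inj₁ (λ _ ())
noGap⇒allFalse⊎interval (suc m) f noGap
  with noGap⇒allFalse⊎interval m f (λ a c b a<c c<b b<m → noGap a c b a<c c<b (m<n⇒m<1+n b<m))
     | true-or-false (f m)
... | inj₁ allFalse | inj₂ fm = inj₁ h
  where
  h : AllFalse f (suc m)
  h k k<1+m with m<1+n⇒m<n∨m≡n k<1+m
  ... | inj₁ k<m = allFalse k k<m
  ... | inj₂ refl = fm
... | inj₁ allFalse | inj₁ fm = inj₂ ((m , m) , (≤-refl , ≤-refl) , h)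
  where
  h : ∀ k → k < suc m → f k ≡ inInterval m m k
  h k k<1+m with m<1+n⇒m<n∨m≡n k<1+m
  ... | inj₁ k<m = trans (allFalse k k<m) (sym (inInterval-below m m k k<m))
  ... | inj₂ refl = trans fm (sym (inInterval≡true {k} {k} {k} ≤-refl ≤-refl))
... | inj₂ ((s , e) , (s≤e , e<m) , h) | inj₂ fm = inj₂ ((s , e) , (s≤e , m<n⇒m<1+n e<m) , h′)
  where
  h′ : ∀ k → k < suc m → f k ≡ inInterval s e k
  h′ k k<1+m with m<1+n⇒m<n∨m≡n k<1+m
  ... | inj₁ k<m = h k k<m
  ... | inj₂ refl = trans fm (sym (inInterval-above s e k e<m))
... | inj₂ ((s , e) , (s≤e , e<m) , h) | inj₁ fm with m≤n⇒m<n∨m≡n e<m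
...   | inj₂ refl = inj₂ ((s , m) , (m≤n⇒m≤1+n s≤e , ≤-refl) , h′)
  where
  h′ : ∀ k → k < suc (suc e) → f k ≡ inInterval s (suc e) k
  h′ k k<2+e with m<1+n⇒m<n∨m≡n k<2+e
  ... | inj₁ k<1+e = trans (h k k<1+e) (inInterval-extend s e k (m<1+n⇒m≤n k<1+e))
  ... | inj₂ refl = trans fm (sym (inInterval≡true (m≤n⇒m≤1+n s≤e) ≤-refl))
...   | inj₁ 1+e<m = ⊥-elim (noGap s (suc e) m (s≤s s≤e) 1+e<m ≤-refl
          (trans (h s (≤-<-trans s≤e e<m)) (inInterval≡true ≤-refl s≤e))
          (trans (h (suc e) 1+e<m) (inInterval-above s e (suc e) ≤-refl)) fm)

inInterval-injective : ∀ {m s e s′ e′} → Interval m (s , e) → Interval m (s′ , e′) →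
  (∀ k → k < m → inInterval s e k ≡ inInterval s′ e′ k) → (s , e) ≡ (s′ , e′)
inInterval-injective {m} {s} {e} {s′} {e′} (s≤e , e<m) (s′≤e′ , e′<m) same = cong₂ _,_ s≡s′ e≡e′
  where
  s≡s′ : s ≡ s′
  s≡s′ with <-cmp s s′
  ... | tri≈ _ eq _ = eq
  ... | tri< s<s′ _ _ = ⊥-elim (true≢false (trans (sym (inInterval≡true ≤-refl s≤e))
          (trans (same s (≤-<-trans s≤e e<m)) (inInterval-below s′ e′ s s<s′))))
  ... | tri> _ _ s>s′ = ⊥-elim (true≢false (trans (sym (inInterval≡true ≤-refl s′≤e′))
          (trans (sym (same s′ (≤-<-trans s′≤e′ e′<m))) (inInterval-below s e s′ s>s′))))
  e≡e′ : e ≡ e′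
  e≡e′ with <-cmp e e′
  ... | tri≈ _ eq _ = eq
  ... | tri< e<e′ _ _ = ⊥-elim (true≢false (trans (sym (inInterval≡true s′≤e′ ≤-refl))
          (trans (sym (same e′ e′<m)) (inInterval-above s e e′ e<e′))))
  ... | tri> _ _ e>e′ = ⊥-elim (true≢false (trans (sym (inInterval≡true s≤e ≤-refl))
          (trans (same e e<m) (inInterval-above s′ e′ e e>e′))))

-- Connected subgraphs through their edge sets

module ConnectedEdgeSets (n : ℕ) (E : ℕ → ℕ → Set) where

  G : Graph n
  G = SymOn n E

  data Walk (X : ℕ → ℕ → Bool) : ℕ → ℕ → Set where
    [] : ∀ {a} → Walk X a a
    _∷_ : ∀ {a w b} → X a w ≡ true ⊎ X w a ≡ true → Walk X w b → Walk X a b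

  Walk-trans : ∀ {X a b c} → Walk X a b → Walk X b c → Walk X a c
  Walk-trans [] q = q
  Walk-trans (e ∷ p) q = e ∷ Walk-trans p q

  Walk-sym : ∀ {X a b} → Walk X a b → Walk X b a
  Walk-sym [] = []
  Walk-sym (e ∷ p) = Walk-trans (Walk-sym p) (Data.Sum.swap e ∷ [])

  Walk-edge : ∀ {X a b} → X a b ≡ true → Walk X a b
  Walk-edge e = inj₁ e ∷ []

  Walk-consecutive : ∀ X i j → i ≤ j → (∀ k → i ≤ k → k < j → X k (suc k) ≡ true) → Walk X i j
  Walk-consecutive X _ zero z≤n _ = []
  Walk-consecutive X i (suc j) i≤1+j edge with m≤n⇒m<n∨m≡n i≤1+j
  ... | inj₂ refl = []
  ... | inj₁ (s≤s i≤j) =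
    Walk-trans (Walk-consecutive X i j i≤j (λ k i≤k k<j → edge k i≤k (m<n⇒m<1+n k<j)))
               (Walk-edge (edge j i≤j ≤-refl))

  IsEdgeSet : (ℕ → ℕ → Bool) → Set
  IsEdgeSet X = ∀ a b → X a b ≡ true → a < b × b < n × E a b

  NonEmpty : (ℕ → ℕ → Bool) → Set
  NonEmpty X = Σ ℕ λ a → Σ ℕ λ b → X a b ≡ true

  Rooted : (ℕ → ℕ → Bool) → Set
  Rooted X = Σ ℕ λ r → ∀ a b → X a b ≡ true → Walk X a r

  singleton : ℕ → SubgraphData n
  singleton k = tabulateℕ n (_≡ᵇ k) , tabulateℕ² n n (λ _ _ → false)

  endpoint : (ℕ → ℕ → Bool) → ℕ → Bool
  endpoint X v = anyBelow n (λ w → X v w ∨ X w v)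

  spannedBy : (ℕ → ℕ → Bool) → SubgraphData n
  spannedBy X = tabulateℕ n (endpoint X) , tabulateℕ² n n X

  module _ {V : Vec Bool n} {M : Vec (Vec Bool n) n} (C : IsConnSub G (V , M)) where
    open IsConnSub C using (edges; connected)

    IsConnSub-edge : ∀ a b → entry M a b ≡ true →
      a < b × b < n × (E a b ⊎ E b a) × lookupℕ V a false ≡ true × lookupℕ V b false ≡ true
    IsConnSub-edge a b e with a <? n | b <? n
    ... | no a≮n | _ = ⊥-elim (true≢false (trans (sym e) (entry-outˡ M a b (≮⇒≥ a≮n))))
    ... | yes _ | no b≮n = ⊥-elim (true≢false (trans (sym e) (entry-outʳ M a b (≮⇒≥ b≮n))))
    ... | yes a<n | yes b<n
      with edges (fromℕ< a<n) (fromℕ< b<n)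
             (trans (lookup²≡entry M _ _)
                    (subst₂ (λ x y → entry M x y ≡ true) (sym (toℕ-fromℕ< a<n)) (sym (toℕ-fromℕ< b<n)) e))
    ... | a<b , Gab , Va , Vb =
      subst₂ _<_ (toℕ-fromℕ< a<n) (toℕ-fromℕ< b<n) a<b , b<n ,
      subst₂ (λ x y → E x y ⊎ E y x) (toℕ-fromℕ< a<n) (toℕ-fromℕ< b<n) Gab ,
      trans (sym (lookupℕ-fromℕ< V a<n false)) Va , trans (sym (lookupℕ-fromℕ< V b<n false)) Vb

    IsConnSub-cut : (side : ℕ → Bool) → (∀ a b → entry M a b ≡ true → side a ≡ side b) →
      ∀ u v → u < n → v < n → lookupℕ V u false ≡ true → lookupℕ V v false ≡ true → side u ≡ side v
    IsConnSub-cut side respects u v u<n v<n Vu Vv =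
      subst₂ (λ x y → side x ≡ side y) (toℕ-fromℕ< u<n) (toℕ-fromℕ< v<n)
        (along (connected (fromℕ< u<n) (fromℕ< v<n)
                  (trans (lookupℕ-fromℕ< V u<n false) Vu) (trans (lookupℕ-fromℕ< V v<n false) Vv)))
      where
      along : ∀ {x y} → Reach M x y → side (toℕ x) ≡ side (toℕ y)
      along here = refl
      along (step (inj₁ e) r) = trans (respects _ _ (trans (sym (lookup²≡entry M _ _)) e)) (along r)
      along (step (inj₂ e) r) = trans (sym (respects _ _ (trans (sym (lookup²≡entry M _ _)) e))) (along r)

  Walk⇒Reach : ∀ X → IsEdgeSet X → ∀ {a b} → Walk X a b →
    (u v : Fin n) → toℕ u ≡ a → toℕ v ≡ b → Reach (tabulateℕ² n n X) u v
  Walk⇒Reach X isEdgeSet [] u v refl v≡u = subst (Reach _ u) (sym (toℕ-injective v≡u)) here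
  Walk⇒Reach X isEdgeSet (_∷_ {w = w} e p) u v refl q =
    step (edgeIn e) (Walk⇒Reach X isEdgeSet p (fromℕ< (w<n e)) v (toℕ-fromℕ< (w<n e)) q)
    where
    w<n : X (toℕ u) w ≡ true ⊎ X w (toℕ u) ≡ true → w < n
    w<n (inj₁ e) = proj₁ (proj₂ (isEdgeSet _ _ e))
    w<n (inj₂ e) = <-trans (proj₁ (isEdgeSet _ _ e)) (toℕ<n u)
    edgeIn : (e : X (toℕ u) w ≡ true ⊎ X w (toℕ u) ≡ true) → EdgeIn (tabulateℕ² n n X) u (fromℕ< (w<n e))
    edgeIn (inj₁ e) = inj₁ (trans (lookup²-tabulateℕ² n X _ _)
                              (subst (λ z → X (toℕ u) z ≡ true) (sym (toℕ-fromℕ< (w<n (inj₁ e)))) e))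
    edgeIn (inj₂ e) = inj₂ (trans (lookup²-tabulateℕ² n X _ _)
                              (subst (λ z → X z (toℕ u) ≡ true) (sym (toℕ-fromℕ< (w<n (inj₂ e)))) e))

  spannedBy-isConnSub : ∀ X → IsEdgeSet X → NonEmpty X → Rooted X → IsConnSub G (spannedBy X)
  spannedBy-isConnSub X isEdgeSet (a₀ , b₀ , e₀) (r , toRoot) =
    record { nonempty = nonempty ; edges = edges ; connected = connected }
    where
    Vs : Vec Bool n
    Vs = tabulateℕ n (endpoint X)
    V : ∀ v → lookup Vs v ≡ endpoint X (toℕ v)
    V = lookup-tabulateℕ n (endpoint X)
    a₀<b₀ = proj₁ (isEdgeSet _ _ e₀)
    b₀<n = proj₁ (proj₂ (isEdgeSet _ _ e₀))
    nonempty : ∃ λ v → lookup Vs v ≡ true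
    nonempty = fromℕ< (<-trans a₀<b₀ b₀<n) ,
      trans (V _) (subst (λ z → endpoint X z ≡ true) (sym (toℕ-fromℕ< (<-trans a₀<b₀ b₀<n)))
                         (anyBelow-intro n _ b₀ b₀<n (∨≡trueˡ _ e₀)))
    edges : ∀ i j → InE (tabulateℕ² n n X) i j →
      toℕ i < toℕ j × G i j × lookup Vs i ≡ true × lookup Vs j ≡ true
    edges i j e with trans (sym (lookup²-tabulateℕ² n X i j)) e
    ... | Xij with isEdgeSet _ _ Xij
    ... | i<j , _ , Eij = i<j , inj₁ Eij ,
          trans (V i) (anyBelow-intro n _ (toℕ j) (toℕ<n j) (∨≡trueˡ _ Xij)) ,
          trans (V j) (anyBelow-intro n _ (toℕ i) (toℕ<n i) (∨≡trueʳ _ Xij))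
    endpoint⇒Walk : ∀ v → endpoint X v ≡ true → Walk X v r
    endpoint⇒Walk v e with anyBelow-witness n _ e
    ... | w , _ , e′ with ∨≡true⇒⊎ {X v w} e′
    ... | inj₁ Xvw = toRoot v w Xvw
    ... | inj₂ Xwv = inj₂ Xwv ∷ toRoot w v Xwv
    connected : ∀ u v → lookup Vs u ≡ true → lookup Vs v ≡ true → Reach (tabulateℕ² n n X) u v
    connected u v Vu Vv =
      Walk⇒Reach X isEdgeSet
        (Walk-trans (endpoint⇒Walk _ (trans (sym (V u)) Vu)) (Walk-sym (endpoint⇒Walk _ (trans (sym (V v)) Vv))))
        u v refl refl

  singleton-isConnSub : ∀ k → k < n → IsConnSub G (singleton k)
  singleton-isConnSub k k<n = record { nonempty = nonempty ; edges = edges ; connected = connected }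
    where
    Vs : Vec Bool n
    Vs = tabulateℕ n (_≡ᵇ k)
    V : ∀ v → lookup Vs v ≡ (toℕ v ≡ᵇ k)
    V = lookup-tabulateℕ n (_≡ᵇ k)
    nonempty : ∃ λ v → lookup Vs v ≡ true
    nonempty = fromℕ< k<n , trans (V _) (≡⇒≡ᵇ≡true _ _ (toℕ-fromℕ< k<n))
    edges : ∀ i j → InE (tabulateℕ² n n (λ _ _ → false)) i j →
      toℕ i < toℕ j × G i j × lookup Vs i ≡ true × lookup Vs j ≡ true
    edges i j e = ⊥-elim (true≢false (trans (sym e) (lookup²-tabulateℕ² n _ i j)))
    connected : ∀ u v → lookup Vs u ≡ true → lookup Vs v ≡ true → Reach (tabulateℕ² n n (λ _ _ → false)) u v
    connected u v Vu Vv = subst (Reach _ u) (toℕ-injective (trans (≡ᵇ≡true⇒≡ _ _ (trans (sym (V u)) Vu))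
                                                              (sym (≡ᵇ≡true⇒≡ _ _ (trans (sym (V v)) Vv))))) here

  firstStep : ∀ {M : Vec (Vec Bool n) n} {u v} → Reach M u v → u ≡ v ⊎ Σ (Fin n) (EdgeIn M u)
  firstStep here = inj₁ refl
  firstStep (step e _) = inj₂ (_ , e)

  module _ {V : Vec Bool n} {M : Vec (Vec Bool n) n} (C : IsConnSub G (V , M)) where
    open IsConnSub C using (nonempty; connected)

    private
      connected′ : ∀ v (v<n : v < n) w → lookupℕ V v false ≡ true → lookup V w ≡ true →
        Reach M (fromℕ< v<n) w
      connected′ v v<n w Vv Vw = connected _ w (trans (lookupℕ-fromℕ< V v<n false) Vv) Vw

      entryOf : ∀ {u w} → InE M u w → entry M (toℕ u) (toℕ w) ≡ true
      entryOf e = trans (sym (lookup²≡entry M _ _)) e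

    IsConnSub-edgeless : (∀ a b → a < n → b < n → entry M a b ≡ false) →
      Σ ℕ λ v → v < n × singleton v ≡ (V , M)
    IsConnSub-edgeless noEdge =
      toℕ v₀ , toℕ<n v₀ ,
      sym (cong₂ _,_ (≡tabulateℕ V _ false (λ v v<n → ≡true-ext (onlyV₀ v v<n) (isV₀ v)))
                     (≡tabulateℕ² M (λ _ _ → false) noEdge))
      where
      v₀ = proj₁ nonempty
      onlyV₀ : ∀ v (v<n : v < n) → lookupℕ V v false ≡ true → (v ≡ᵇ toℕ v₀) ≡ true
      onlyV₀ v v<n Vv with firstStep (connected′ v v<n v₀ Vv (proj₂ nonempty))
      ... | inj₁ eq = ≡⇒≡ᵇ≡true v (toℕ v₀) (trans (sym (toℕ-fromℕ< v<n)) (cong toℕ eq))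
      ... | inj₂ (w , inj₁ e) =
        ⊥-elim (true≢false (trans (sym (entryOf e)) (noEdge _ _ (toℕ<n (fromℕ< v<n)) (toℕ<n w))))
      ... | inj₂ (w , inj₂ e) =
        ⊥-elim (true≢false (trans (sym (entryOf e)) (noEdge _ _ (toℕ<n w) (toℕ<n (fromℕ< v<n)))))
      isV₀ : ∀ v → (v ≡ᵇ toℕ v₀) ≡ true → lookupℕ V v false ≡ true
      isV₀ v e = trans (cong (λ z → lookupℕ V z false) (≡ᵇ≡true⇒≡ v (toℕ v₀) e))
                       (trans (sym (lookup≡lookupℕ V v₀ false)) (proj₂ nonempty))

    IsConnSub-spannedBy : ∀ X → (∀ a b → entry M a b ≡ X a b) → ∀ a b → X a b ≡ true →
      spannedBy X ≡ (V , M)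
    IsConnSub-spannedBy X M≡X a b Xab =
      sym (cong₂ _,_ (≡tabulateℕ V (endpoint X) false (λ v v<n → ≡true-ext (V⇒endpoint v v<n) (endpoint⇒V v)))
                     (≡tabulateℕ² M X (λ a b _ _ → M≡X a b)))
      where
      Mab : entry M a b ≡ true
      Mab = trans (M≡X a b) Xab
      a<n = <-trans (proj₁ (IsConnSub-edge C a b Mab)) (proj₁ (proj₂ (IsConnSub-edge C a b Mab)))
      b<n = proj₁ (proj₂ (IsConnSub-edge C a b Mab))
      Va = proj₁ (proj₂ (proj₂ (proj₂ (IsConnSub-edge C a b Mab))))
      V⇒endpoint : ∀ v → v < n → lookupℕ V v false ≡ true → endpoint X v ≡ true
      V⇒endpoint v v<n Vv with firstStep (connected′ v v<n (fromℕ< a<n) Vv (trans (lookupℕ-fromℕ< V a<n false) Va))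
      ... | inj₁ eq = anyBelow-intro n _ b b<n (∨≡trueˡ _ (subst (λ z → X z b ≡ true) a≡v Xab))
        where
        a≡v : a ≡ v
        a≡v = trans (sym (toℕ-fromℕ< a<n)) (trans (cong toℕ (sym eq)) (toℕ-fromℕ< v<n))
      ... | inj₂ (w , inj₁ e) = anyBelow-intro n _ (toℕ w) (toℕ<n w)
              (∨≡trueˡ _ (trans (sym (M≡X v (toℕ w)))
                                (subst (λ z → entry M z (toℕ w) ≡ true) (toℕ-fromℕ< v<n) (entryOf e))))
      ... | inj₂ (w , inj₂ e) = anyBelow-intro n _ (toℕ w) (toℕ<n w)
              (∨≡trueʳ (X v (toℕ w)) (trans (sym (M≡X (toℕ w) v))
                                           (subst (λ z → entry M (toℕ w) z ≡ true) (toℕ-fromℕ< v<n) (entryOf e))))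
      endpoint⇒V : ∀ v → endpoint X v ≡ true → lookupℕ V v false ≡ true
      endpoint⇒V v e with anyBelow-witness n _ e
      ... | w , _ , e′ with ∨≡true⇒⊎ {X v w} e′
      ... | inj₁ Xvw = proj₁ (proj₂ (proj₂ (proj₂ (IsConnSub-edge C v w (trans (M≡X v w) Xvw)))))
      ... | inj₂ Xwv = proj₂ (proj₂ (proj₂ (proj₂ (IsConnSub-edge C w v (trans (M≡X w v) Xwv)))))

  IsEdgeSet-outside : ∀ X → IsEdgeSet X → ∀ a b → ¬ (a < n × b < n) → X a b ≡ false
  IsEdgeSet-outside X isEdgeSet a b out with X a b in e
  ... | false = refl
  ... | true = let (a<b , b<n , _) = isEdgeSet a b e in ⊥-elim (out (<-trans a<b b<n , b<n))

  spannedBy-injective : ∀ X Y → IsEdgeSet X → IsEdgeSet Y → spannedBy X ≡ spannedBy Y →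
    ∀ a b → X a b ≡ Y a b
  spannedBy-injective X Y isEdgeSetX isEdgeSetY eq a b with a <? n | b <? n
  ... | yes a<n | yes b<n =
    trans (sym (entry-tabulateℕ² n n X a b a<n b<n))
          (trans (cong (λ S → entry (proj₂ S) a b) eq) (entry-tabulateℕ² n n Y a b a<n b<n))
  ... | no a≮n | _ =
    trans (IsEdgeSet-outside X isEdgeSetX a b (a≮n ∘ proj₁)) (sym (IsEdgeSet-outside Y isEdgeSetY a b (a≮n ∘ proj₁)))
  ... | yes _ | no b≮n =
    trans (IsEdgeSet-outside X isEdgeSetX a b (b≮n ∘ proj₂)) (sym (IsEdgeSet-outside Y isEdgeSetY a b (b≮n ∘ proj₂)))

  singleton-injective : ∀ {v w} → v < n → w < n → singleton v ≡ singleton w → v ≡ w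
  singleton-injective {v} {w} v<n w<n eq = ≡ᵇ≡true⇒≡ v w (begin
    (v ≡ᵇ w)                                 ≡⟨ lookupℕ-tabulateℕ n (_≡ᵇ w) v false v<n ⟨
    lookupℕ (proj₁ (singleton w)) v false   ≡⟨ cong (λ S → lookupℕ (proj₁ S) v false) eq ⟨
    lookupℕ (proj₁ (singleton v)) v false   ≡⟨ lookupℕ-tabulateℕ n (_≡ᵇ v) v false v<n ⟩
    (v ≡ᵇ v)                                 ≡⟨ ≡⇒≡ᵇ≡true v v refl ⟩
    true                                     ∎)
    where open ≡-Reasoning

  singleton≢spannedBy : ∀ v X → IsEdgeSet X → NonEmpty X → singleton v ≢ spannedBy X
  singleton≢spannedBy v X isEdgeSet (a , b , Xab) eq = true≢false (begin
    true                                   ≡⟨ Xab ⟨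
    X a b                                  ≡⟨ entry-tabulateℕ² n n X a b a<n b<n ⟨
    entry (proj₂ (spannedBy X)) a b        ≡⟨ cong (λ S → entry (proj₂ S) a b) eq ⟨
    entry (proj₂ (singleton v)) a b        ≡⟨ entry-tabulateℕ² n n (λ _ _ → false) a b a<n b<n ⟩
    false                                  ∎)
    where
    open ≡-Reasoning
    b<n = proj₁ (proj₂ (isEdgeSet a b Xab))
    a<n = <-trans (proj₁ (isEdgeSet a b Xab)) b<n

  record Enumeration (k : ℕ) : Set₁ where
    field
      Index : Set
      Valid : Index → Set
      count : HasCount Valid k
      edgeSet : Index → ℕ → ℕ → Bool
      isEdgeSet : ∀ i → Valid i → IsEdgeSet (edgeSet i)
      nonEmpty : ∀ i → Valid i → NonEmpty (edgeSet i)
      rooted : ∀ i → Valid i → Rooted (edgeSet i)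
      injective : ∀ i j → Valid i → Valid j → (∀ a b → edgeSet i a b ≡ edgeSet j a b) → i ≡ j
      complete : ∀ V M → IsConnSub G (V , M) → ∀ a b → entry M a b ≡ true →
        Σ Index λ i → Valid i × (∀ a b → entry M a b ≡ edgeSet i a b)

  coreIndex : ∀ {k} → Enumeration k → CoreIndexIs G (n + k)
  coreIndex {k} enum = HasCount-resp sound complete′ (HasCount-⊎ disjoint vertices edgeSets)
    where
    open Enumeration enum
    IsSingleton IsSpanned : SubgraphData n → Set
    IsSingleton S = Σ ℕ λ v → v < n × singleton v ≡ S
    IsSpanned S = Σ Index λ i → Valid i × spannedBy (edgeSet i) ≡ S
    vertices : HasCount IsSingleton n
    vertices = HasCount-image singleton singleton-injective (HasCount-< n)
    edgeSets : HasCount IsSpanned k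
    edgeSets = HasCount-image (spannedBy ∘ edgeSet)
      (λ {i} {j} vi vj eq → injective i j vi vj (spannedBy-injective _ _ (isEdgeSet i vi) (isEdgeSet j vj) eq)) count
    disjoint : ∀ S → IsSingleton S → IsSpanned S → ⊥
    disjoint S (v , _ , refl) (i , vi , eq) = singleton≢spannedBy v (edgeSet i) (isEdgeSet i vi) (nonEmpty i vi) (sym eq)
    sound : ∀ S → IsSingleton S ⊎ IsSpanned S → IsConnSub G S
    sound S (inj₁ (v , v<n , refl)) = singleton-isConnSub v v<n
    sound S (inj₂ (i , vi , refl)) = spannedBy-isConnSub (edgeSet i) (isEdgeSet i vi) (nonEmpty i vi) (rooted i vi)
    complete′ : ∀ S → IsConnSub G S → IsSingleton S ⊎ IsSpanned S
    complete′ (V , M) C with anyBelow n (λ a → anyBelow n (entry M a)) in hasEdge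
    ... | false =
      inj₁ (IsConnSub-edgeless C (λ a b a<n → anyBelow≡false⇒ n _ (anyBelow≡false⇒ n _ hasEdge a a<n) b))
    ... | true with anyBelow-witness n _ hasEdge
    ... | a , _ , e with anyBelow-witness n _ e
    ... | b , _ , Mab with complete V M C a b Mab
    ... | i , vi , M≡ = inj₂ (i , vi , IsConnSub-spannedBy C (edgeSet i) M≡ a b (trans (sym (M≡ a b)) Mab))

-- The cycle

cycleEdgeSets : ℕ → ℕ
cycleEdgeSets m = triangle m + (triangle m + 1)

module CycleCount (m : ℕ) (2≤m : 2 ≤ m) where

  open ConnectedEdgeSets (suc m) (CycleE (suc m))

  cycleEdges : (ℕ → Bool) → Bool → ℕ → ℕ → Bool
  cycleEdges path closing a b = ((b ≡ᵇ suc a) ∧ path a) ∨ (closing ∧ ((a ≡ᵇ 0) ∧ (b ≡ᵇ m)))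

  CycleEdgeForm : (ℕ → Bool) → Bool → ℕ → ℕ → Set
  CycleEdgeForm path closing a b = (b ≡ suc a × path a ≡ true) ⊎ (closing ≡ true × a ≡ 0 × b ≡ m)

  cycleEdges≡true⇒ : ∀ path closing a b → cycleEdges path closing a b ≡ true → CycleEdgeForm path closing a b
  cycleEdges≡true⇒ path closing a b e with ∨≡true⇒⊎ {(b ≡ᵇ suc a) ∧ path a} e
  ... | inj₁ x = let (p , q) = ∧≡true⇒× {b ≡ᵇ suc a} x in inj₁ (≡ᵇ≡true⇒≡ b (suc a) p , q)
  ... | inj₂ x = let (p , q) = ∧≡true⇒× {closing} x ; (r , t) = ∧≡true⇒× {a ≡ᵇ 0} q in
                 inj₂ (p , ≡ᵇ≡true⇒≡ a 0 r , ≡ᵇ≡true⇒≡ b m t)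

  cycleEdges-path : ∀ path closing a → path a ≡ true → cycleEdges path closing a (suc a) ≡ true
  cycleEdges-path path closing a e = ∨≡trueˡ _ (×⇒∧≡true (≡⇒≡ᵇ≡true (suc a) (suc a) refl) e)

  cycleEdges-closing : ∀ path → cycleEdges path true 0 m ≡ true
  cycleEdges-closing path = ∨≡trueʳ ((m ≡ᵇ 1) ∧ path 0) (≡⇒≡ᵇ≡true m m refl)

  cycleEdges-cong : ∀ path path′ closing → (∀ k → path k ≡ path′ k) → ∀ a b →
    cycleEdges path closing a b ≡ cycleEdges path′ closing a b
  cycleEdges-cong path path′ closing same a b rewrite same a = refl

  cycleEdges-pathBit : ∀ path closing k → cycleEdges path closing k (suc k) ≡ path k
  cycleEdges-pathBit path closing k = ≡true-ext fromEdge (cycleEdges-path path closing k)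
    where
    fromEdge : cycleEdges path closing k (suc k) ≡ true → path k ≡ true
    fromEdge e with cycleEdges≡true⇒ path closing k (suc k) e
    ... | inj₁ (_ , pk) = pk
    ... | inj₂ (_ , refl , 1≡m) = ⊥-elim (<-irrefl 1≡m 2≤m)

  cycleEdges-closingBit : ∀ path closing → cycleEdges path closing 0 m ≡ closing
  cycleEdges-closingBit path closing = ≡true-ext fromEdge (λ { refl → cycleEdges-closing path })
    where
    fromEdge : cycleEdges path closing 0 m ≡ true → closing ≡ true
    fromEdge e with cycleEdges≡true⇒ path closing 0 m e
    ... | inj₁ (m≡1 , _) = ⊥-elim (<-irrefl (sym m≡1) 2≤m)
    ... | inj₂ (c , _) = c

  data Shape : Set where
    arc coarc : ℕ → ℕ → Shape
    whole : Shape

  ValidShape : Shape → Set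
  ValidShape (arc s e) = Interval m (s , e)
  ValidShape (coarc s e) = Interval m (s , e)
  ValidShape whole = ⊤

  outsideInterval : ℕ → ℕ → ℕ → Bool
  outsideInterval s e k = not (inInterval s e k) ∧ (k <ᵇ m)

  pathOf : Shape → ℕ → Bool
  pathOf (arc s e) = inInterval s e
  pathOf (coarc s e) = outsideInterval s e
  pathOf whole = _<ᵇ m

  closingOf : Shape → Bool
  closingOf (arc _ _) = false
  closingOf (coarc _ _) = true
  closingOf whole = true

  edgesOf : Shape → ℕ → ℕ → Bool
  edgesOf σ = cycleEdges (pathOf σ) (closingOf σ)

  HasCount-ValidShape : HasCount ValidShape (cycleEdgeSets m)
  HasCount-ValidShape =
    HasCount-resp to from
      (HasCount-⊎ arc≢ (HasCount-image (uncurry arc) (λ { {_ , _} {_ , _} _ _ refl → refl }) (HasCount-Interval m))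
      (HasCount-⊎ coarc≢ (HasCount-image (uncurry coarc) (λ { {_ , _} {_ , _} _ _ refl → refl })
                                                           (HasCount-Interval m))
                         (HasCount-singleton whole)))
    where
    IsArc IsCoarc : Shape → Set
    IsArc σ = Σ (ℕ × ℕ) λ p → Interval m p × uncurry arc p ≡ σ
    IsCoarc σ = Σ (ℕ × ℕ) λ p → Interval m p × uncurry coarc p ≡ σ
    arc≢ : ∀ σ → IsArc σ → IsCoarc σ ⊎ whole ≡ σ → ⊥
    arc≢ _ (_ , _ , refl) (inj₁ (_ , _ , ()))
    arc≢ _ (_ , _ , refl) (inj₂ ())
    coarc≢ : ∀ σ → IsCoarc σ → whole ≡ σ → ⊥
    coarc≢ _ (_ , _ , refl) ()
    to : ∀ σ → IsArc σ ⊎ (IsCoarc σ ⊎ whole ≡ σ) → ValidShape σ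
    to _ (inj₁ (_ , v , refl)) = v
    to _ (inj₂ (inj₁ (_ , v , refl))) = v
    to _ (inj₂ (inj₂ refl)) = tt
    from : ∀ σ → ValidShape σ → IsArc σ ⊎ (IsCoarc σ ⊎ whole ≡ σ)
    from (arc s e) v = inj₁ ((s , e) , v , refl)
    from (coarc s e) v = inj₂ (inj₁ ((s , e) , v , refl))
    from whole _ = inj₂ (inj₂ refl)

  pathOf-range : ∀ σ → ValidShape σ → ∀ k → pathOf σ k ≡ true → k < m
  pathOf-range (arc s e) (_ , e<m) k x = ≤-<-trans (proj₂ (inInterval≡true⇒ s e k x)) e<m
  pathOf-range (coarc s e) _ k x = <ᵇ≡true⇒< k m (proj₂ (∧≡true⇒× {not (inInterval s e k)} x))
  pathOf-range whole _ k x = <ᵇ≡true⇒< k m x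

  edgesOf-isEdgeSet : ∀ σ → ValidShape σ → IsEdgeSet (edgesOf σ)
  edgesOf-isEdgeSet σ vσ a b x with cycleEdges≡true⇒ (pathOf σ) (closingOf σ) a b x
  ... | inj₁ (refl , pa) = ≤-refl , s≤s (pathOf-range σ vσ a pa) , inj₁ (refl , s≤s (pathOf-range σ vσ a pa))
  ... | inj₂ (_ , refl , refl) = ≤-trans (s≤s z≤n) 2≤m , ≤-refl , inj₂ (refl , refl)

  edgesOf-nonEmpty : ∀ σ → ValidShape σ → NonEmpty (edgesOf σ)
  edgesOf-nonEmpty (arc s e) (s≤e , _) =
    s , suc s , cycleEdges-path (inInterval s e) false s (inInterval≡true ≤-refl s≤e)
  edgesOf-nonEmpty (coarc s e) _ = 0 , m , cycleEdges-closing (outsideInterval s e)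
  edgesOf-nonEmpty whole _ = 0 , m , cycleEdges-closing (_<ᵇ m)

  walkAlongPath : ∀ σ i j → i ≤ j → (∀ k → i ≤ k → k < j → pathOf σ k ≡ true) → Walk (edgesOf σ) i j
  walkAlongPath σ i j i≤j onPath =
    Walk-consecutive (edgesOf σ) i j i≤j λ k i≤k k<j →
      cycleEdges-path (pathOf σ) (closingOf σ) k (onPath k i≤k k<j)

  edgesOf-rooted : ∀ σ → ValidShape σ → Rooted (edgesOf σ)
  edgesOf-rooted (arc s e) (s≤e , _) = s , λ a b x → toRoot a (cycleEdges≡true⇒ (inInterval s e) false a b x)
    where
    toRoot : ∀ a {b} → CycleEdgeForm (inInterval s e) false a b → Walk (edgesOf (arc s e)) a s
    toRoot a (inj₁ (_ , pa)) = let (s≤a , a≤e) = inInterval≡true⇒ s e a pa in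
      Walk-sym (walkAlongPath (arc s e) s a s≤a λ k s≤k k<a → inInterval≡true s≤k (≤-trans (<⇒≤ k<a) a≤e))
  edgesOf-rooted (coarc s e) (s≤e , _) = 0 , λ a b x → toRoot a (cycleEdges≡true⇒ (outsideInterval s e) true a b x)
    where
    outside : ∀ {k} → k < m → inInterval s e k ≡ false → outsideInterval s e k ≡ true
    outside k<m notIn = ×⇒∧≡true (cong not notIn) (<⇒<ᵇ≡true k<m)
    toRoot : ∀ a {b} → CycleEdgeForm (outsideInterval s e) true a b → Walk (edgesOf (coarc s e)) a 0
    toRoot _ (inj₂ (_ , refl , _)) = []
    toRoot a (inj₁ (_ , pa)) with ∧≡true⇒× {not (inInterval s e a)} pa
    ... | a∉ , a<ᵇm with <ᵇ≡true⇒< a m a<ᵇm | <-cmp a s | <-cmp e a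
    ... | a<m | tri< a<s _ _ | _ =
      Walk-sym (walkAlongPath (coarc s e) 0 a z≤n λ k _ k<a →
                  outside (<-trans k<a a<m) (inInterval-below s e k (<-trans k<a a<s)))
    ... | a<m | _ | tri< e<a _ _ =
      Walk-trans (walkAlongPath (coarc s e) a m (<⇒≤ a<m) λ k a≤k k<m →
                    outside k<m (inInterval-above s e k (<-≤-trans e<a a≤k)))
                 (inj₂ (cycleEdges-closing (outsideInterval s e)) ∷ [])
    ... | _ | tri≈ _ refl _ | _ = ⊥-elim (true≢false (trans (sym a∉) (cong not (inInterval≡true ≤-refl s≤e))))
    ... | _ | tri> _ _ s<a | tri≈ _ refl _ =
      ⊥-elim (true≢false (trans (sym a∉) (cong not (inInterval≡true (<⇒≤ s<a) ≤-refl))))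
    ... | _ | tri> _ _ s<a | tri> _ _ a<e =
      ⊥-elim (true≢false (trans (sym a∉) (cong not (inInterval≡true (<⇒≤ s<a) (<⇒≤ a<e)))))
  edgesOf-rooted whole _ = 0 , λ a b x → toRoot a (cycleEdges≡true⇒ (_<ᵇ m) true a b x)
    where
    toRoot : ∀ a {b} → CycleEdgeForm (_<ᵇ m) true a b → Walk (edgesOf whole) a 0
    toRoot _ (inj₂ (_ , refl , _)) = []
    toRoot a (inj₁ (_ , pa)) =
      Walk-sym (walkAlongPath whole 0 a z≤n (λ k _ k<a → <⇒<ᵇ≡true (<-trans k<a (<ᵇ≡true⇒< a m pa))))

  outsideInterval-below-m : ∀ s e k → k < m → outsideInterval s e k ≡ not (inInterval s e k)
  outsideInterval-below-m s e k k<m rewrite <⇒<ᵇ≡true k<m = ∧-identityʳ _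

  edgesOf-injective : ∀ σ τ → ValidShape σ → ValidShape τ → (∀ a b → edgesOf σ a b ≡ edgesOf τ a b) →
    σ ≡ τ
  edgesOf-injective σ τ vσ vτ same = fromBits σ τ vσ vτ samePath sameClosing
    where
    samePath : ∀ k → pathOf σ k ≡ pathOf τ k
    samePath k = trans (sym (cycleEdges-pathBit (pathOf σ) (closingOf σ) k))
                       (trans (same k (suc k)) (cycleEdges-pathBit (pathOf τ) (closingOf τ) k))
    sameClosing : closingOf σ ≡ closingOf τ
    sameClosing = trans (sym (cycleEdges-closingBit (pathOf σ) (closingOf σ)))
                        (trans (same 0 m) (cycleEdges-closingBit (pathOf τ) (closingOf τ)))
    startMissing : ∀ s e → Interval m (s , e) → pathOf whole s ≡ true × pathOf (coarc s e) s ≡ false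
    startMissing s e (s≤e , e<m) =
      <⇒<ᵇ≡true (≤-<-trans s≤e e<m) , cong (λ b → not b ∧ (s <ᵇ m)) (inInterval≡true ≤-refl s≤e)
    fromBits : ∀ σ τ → ValidShape σ → ValidShape τ → (∀ k → pathOf σ k ≡ pathOf τ k) →
      closingOf σ ≡ closingOf τ → σ ≡ τ
    fromBits (arc s e) (arc s′ e′) vσ vτ path _ = cong (uncurry arc) (inInterval-injective vσ vτ (λ k _ → path k))
    fromBits (coarc s e) (coarc s′ e′) vσ vτ path _ =
      cong (uncurry coarc) (inInterval-injective vσ vτ (λ k k<m →
        not-injective (trans (sym (outsideInterval-below-m s e k k<m))
                             (trans (path k) (outsideInterval-below-m s′ e′ k k<m)))))
    fromBits whole whole _ _ _ _ = refl
    fromBits (coarc s e) whole vσ _ path _ =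
      let (inWhole , notInCoarc) = startMissing s e vσ in
      ⊥-elim (true≢false (trans (sym inWhole) (trans (sym (path s)) notInCoarc)))
    fromBits whole (coarc s e) _ vτ path _ =
      let (inWhole , notInCoarc) = startMissing s e vτ in
      ⊥-elim (true≢false (trans (sym inWhole) (trans (path s) notInCoarc)))
    fromBits (arc _ _) (coarc _ _) _ _ _ ()
    fromBits (arc _ _) whole _ _ _ ()
    fromBits (coarc _ _) (arc _ _) _ _ _ ()
    fromBits whole (arc _ _) _ _ _ ()

  pathOf-out : ∀ σ → ValidShape σ → ∀ k → m ≤ k → pathOf σ k ≡ false
  pathOf-out σ vσ k m≤k with pathOf σ k in e
  ... | false = refl
  ... | true = ⊥-elim (<⇒≱ (pathOf-range σ vσ k e) m≤k)

  module _ {V : Vec Bool (suc m)} {M : Vec (Vec Bool (suc m)) (suc m)} (C : IsConnSub G (V , M)) where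

    pathBits : ℕ → Bool
    pathBits k = entry M k (suc k)

    closingBit : Bool
    closingBit = entry M 0 m

    entry≡cycleEdges : ∀ a b → entry M a b ≡ cycleEdges pathBits closingBit a b
    entry≡cycleEdges a b = ≡true-ext fromEntry toEntry
      where
      fromEntry : entry M a b ≡ true → cycleEdges pathBits closingBit a b ≡ true
      fromEntry x with IsConnSub-edge C a b x
      ... | _ , _ , inj₁ (inj₁ (refl , _)) , _ = cycleEdges-path pathBits closingBit a x
      ... | _ , _ , inj₁ (inj₂ (refl , refl)) , _ = trans (cycleEdges-closingBit pathBits closingBit) x
      ... | a<b , _ , inj₂ (inj₁ (refl , _)) , _ = ⊥-elim (<-asym a<b ≤-refl)
      ... | a<b , _ , inj₂ (inj₂ (refl , _)) , _ = ⊥-elim (<-irrefl refl (≤-<-trans z≤n a<b))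
      toEntry : cycleEdges pathBits closingBit a b ≡ true → entry M a b ≡ true
      toEntry x with cycleEdges≡true⇒ pathBits closingBit a b x
      ... | inj₁ (refl , pa) = pa
      ... | inj₂ (c , refl , refl) = c

    pathBit-ends : ∀ k → pathBits k ≡ true → lookupℕ V k false ≡ true × lookupℕ V (suc k) false ≡ true
    pathBit-ends k x = let (_ , _ , _ , Vk , V1+k) = IsConnSub-edge C k (suc k) x in Vk , V1+k

    pathBit<m : ∀ k → pathBits k ≡ true → k < m
    pathBit<m k x = ≤-pred (proj₁ (proj₂ (IsConnSub-edge C k (suc k) x)))

    entry≡edgesOf : ∀ σ → ValidShape σ → closingBit ≡ closingOf σ → (∀ k → k < m → pathBits k ≡ pathOf σ k) →
      ∀ a b → entry M a b ≡ edgesOf σ a b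
    entry≡edgesOf σ vσ sameClosing samePath a b =
      trans (entry≡cycleEdges a b)
            (trans (cong (λ c → cycleEdges pathBits c a b) sameClosing)
                   (cycleEdges-cong pathBits (pathOf σ) (closingOf σ) samePath′ a b))
      where
      samePath′ : ∀ k → pathBits k ≡ pathOf σ k
      samePath′ k with k <? m
      ... | yes k<m = samePath k k<m
      ... | no k≮m = trans (entry-outʳ M k (suc k) (s≤s (≮⇒≥ k≮m)))
                           (sym (pathOf-out σ vσ k (≮⇒≥ k≮m)))

    noGap-open : closingBit ≡ false → NoGap pathBits m
    noGap-open open′ a c b a<c c<b b<m pa pc pb =
      true≢false (begin
        true                      ≡⟨ inInterval≡true z≤n (<⇒≤ a<c) ⟨
        inInterval 0 c a          ≡⟨ IsConnSub-cut C (inInterval 0 c) respects a (suc b) a<1+m (s≤s b<m) Va V1+b ⟩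
        inInterval 0 c (suc b)    ≡⟨ inInterval-above 0 c (suc b) (m<n⇒m<1+n c<b) ⟩
        false                     ∎)
      where
      open ≡-Reasoning
      a<1+m = <-trans a<c (<-trans c<b (m<n⇒m<1+n b<m))
      Va = proj₁ (pathBit-ends a pa)
      V1+b = proj₂ (pathBit-ends b pb)
      respects : ∀ a′ b′ → entry M a′ b′ ≡ true → inInterval 0 c a′ ≡ inInterval 0 c b′
      respects a′ b′ x with cycleEdges≡true⇒ pathBits closingBit a′ b′ (trans (sym (entry≡cycleEdges a′ b′)) x)
      ... | inj₁ (refl , pa′) = inInterval-step 0 c a′ (λ ()) (λ { refl → true≢false (trans (sym pa′) pc) })
      ... | inj₂ (closed , _) = ⊥-elim (true≢false (trans (sym closed) open′))

    noGap-closed : closingBit ≡ true → NoGap (not ∘ pathBits) m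
    noGap-closed closed a c b a<c c<b b<m na pc nb =
      true≢false (begin
        true                            ≡⟨ inInterval≡true a<c (<⇒≤ c<b) ⟨
        inInterval (suc a) b c          ≡⟨ IsConnSub-cut C (inInterval (suc a) b) respects c 0 c<1+m (s≤s z≤n) Vc V0 ⟩
        inInterval (suc a) b 0          ≡⟨ inInterval-below (suc a) b 0 (s≤s z≤n) ⟩
        false                           ∎)
      where
      open ≡-Reasoning
      c<1+m = <-trans c<b (m<n⇒m<1+n b<m)
      Vc = proj₁ (pathBit-ends c (trans (sym (not-involutive (pathBits c))) (cong not pc)))
      V0 = proj₁ (proj₂ (proj₂ (proj₂ (IsConnSub-edge C 0 m closed))))
      respects : ∀ a′ b′ → entry M a′ b′ ≡ true → inInterval (suc a) b a′ ≡ inInterval (suc a) b b′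
      respects a′ b′ x with cycleEdges≡true⇒ pathBits closingBit a′ b′ (trans (sym (entry≡cycleEdges a′ b′)) x)
      ... | inj₁ (refl , pa′) =
        inInterval-step (suc a) b a′ (λ { refl → true≢false (trans (sym pa′) (not≡true⇒≡false na)) })
                                     (λ { refl → true≢false (trans (sym pa′) (not≡true⇒≡false nb)) })
      ... | inj₂ (_ , refl , refl) =
        trans (inInterval-below (suc a) b 0 (s≤s z≤n)) (sym (inInterval-above (suc a) b m b<m))

    shape : ∀ a b → entry M a b ≡ true → Σ Shape λ σ → ValidShape σ × (∀ a b → entry M a b ≡ edgesOf σ a b)
    shape a₀ b₀ e₀ with true-or-false closingBit
    ... | inj₂ open′ with noGap⇒allFalse⊎interval m pathBits (noGap-open open′)
    ...   | inj₂ ((s , e) , I , h) = arc s e , I , entry≡edgesOf (arc s e) I open′ h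
    ...   | inj₁ noPath with cycleEdges≡true⇒ pathBits closingBit a₀ b₀ (trans (sym (entry≡cycleEdges a₀ b₀)) e₀)
    ...     | inj₁ (_ , pa) = ⊥-elim (true≢false (trans (sym pa) (noPath a₀ (pathBit<m a₀ pa))))
    ...     | inj₂ (closed , _) = ⊥-elim (true≢false (trans (sym closed) open′))
    shape _ _ _ | inj₁ closed with noGap⇒allFalse⊎interval m (not ∘ pathBits) (noGap-closed closed)
    ...   | inj₁ fullPath = whole , tt , entry≡edgesOf whole tt closed h
      where
      h : ∀ k → k < m → pathBits k ≡ (k <ᵇ m)
      h k k<m = trans (sym (not-involutive (pathBits k))) (trans (cong not (fullPath k k<m)) (sym (<⇒<ᵇ≡true k<m)))
    ...   | inj₂ ((s , e) , I , h) = coarc s e , I , entry≡edgesOf (coarc s e) I closed h′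
      where
      h′ : ∀ k → k < m → pathBits k ≡ outsideInterval s e k
      h′ k k<m = trans (sym (not-involutive (pathBits k)))
                       (trans (cong not (h k k<m)) (sym (outsideInterval-below-m s e k k<m)))

  enumeration : Enumeration (cycleEdgeSets m)
  enumeration = record
    { Index = Shape
    ; Valid = ValidShape
    ; count = HasCount-ValidShape
    ; edgeSet = edgesOf
    ; isEdgeSet = edgesOf-isEdgeSet
    ; nonEmpty = edgesOf-nonEmpty
    ; rooted = edgesOf-rooted
    ; injective = edgesOf-injective
    ; complete = λ V M C → shape C
    }

  coreIndex-Cycle : CoreIndexIs (Cycle (suc m)) (suc m + cycleEdgeSets m)
  coreIndex-Cycle = coreIndex enumeration

-- The graph C_{3,3}^n

c33EdgeSets : ℕ → ℕ
c33EdgeSets k = 7 + (7 + (triangle k + (6 * k + (6 * k + 6 * 6))))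

-- The left triangle is {0, 1, 2} with chord {0, 2}, the right one {K2, K3, K4} with chord
-- {K2, K4}, and the k path edges between them are {t + 2, t + 3} for t < k.
module C33Count (k' : ℕ) where

  k K2 K3 K4 n : ℕ
  k = suc k'
  K2 = suc (suc k)
  K3 = suc K2
  K4 = suc K3
  n = suc K4

  open ConnectedEdgeSets n (C33E n)

  -- (far, near, chord): the far edge avoids the vertex shared with the path, the other two contain it.
  Triangle : Set
  Triangle = Bool × Bool × Bool

  far near chord : Triangle → Bool
  far (f , _ , _) = f
  near (_ , r , _) = r
  chord (_ , _ , c) = c

  anyEdge atJoint : Triangle → Bool
  anyEdge (f , r , c) = f ∨ (r ∨ c)
  atJoint (_ , r , c) = r ∨ c

  noEdges : Triangle
  noEdges = false , false , false

  allTriangles : List Triangle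
  allTriangles =
    (false , false , false) ∷ (true , false , false) ∷ (false , true , false) ∷ (false , false , true) ∷
    (true , true , false) ∷ (true , false , true) ∷ (false , true , true) ∷ (true , true , true) ∷ []

  ∈-allTriangles : ∀ t → t ∈ allTriangles
  ∈-allTriangles (false , false , false) = here refl
  ∈-allTriangles (true , false , false) = there (here refl)
  ∈-allTriangles (false , true , false) = there (there (here refl))
  ∈-allTriangles (false , false , true) = there (there (there (here refl)))
  ∈-allTriangles (true , true , false) = there (there (there (there (here refl))))
  ∈-allTriangles (true , false , true) = there (there (there (there (there (here refl)))))
  ∈-allTriangles (false , true , true) = there (there (there (there (there (there (here refl))))))
  ∈-allTriangles (true , true , true) = there (there (there (there (there (there (there (here refl)))))))

  HasCount-anyEdge : HasCount (λ t → anyEdge t ≡ true) 7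
  HasCount-anyEdge = HasCount-filter allTriangles (toWitness {a? = unique? allTriangles} tt) ∈-allTriangles anyEdge

  HasCount-atJoint : HasCount (λ t → atJoint t ≡ true) 6
  HasCount-atJoint = HasCount-filter allTriangles (toWitness {a? = unique? allTriangles} tt) ∈-allTriangles atJoint

  c33Edges : (ℕ → Bool) → Bool → Bool → ℕ → ℕ → Bool
  c33Edges path left right a b =
    ((b ≡ᵇ suc a) ∧ path a) ∨ ((left ∧ ((a ≡ᵇ 0) ∧ (b ≡ᵇ 2))) ∨ (right ∧ ((a ≡ᵇ K2) ∧ (b ≡ᵇ K4))))

  C33EdgeForm : (ℕ → Bool) → Bool → Bool → ℕ → ℕ → Set
  C33EdgeForm path left right a b =
    (b ≡ suc a × path a ≡ true) ⊎ ((left ≡ true × a ≡ 0 × b ≡ 2) ⊎ (right ≡ true × a ≡ K2 × b ≡ K4))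

  c33Edges≡true⇒ : ∀ path left right a b → c33Edges path left right a b ≡ true → C33EdgeForm path left right a b
  c33Edges≡true⇒ path left right a b e with ∨≡true⇒⊎ {(b ≡ᵇ suc a) ∧ path a} e
  ... | inj₁ x = let (p , q) = ∧≡true⇒× {b ≡ᵇ suc a} x in inj₁ (≡ᵇ≡true⇒≡ b (suc a) p , q)
  ... | inj₂ x with ∨≡true⇒⊎ {left ∧ ((a ≡ᵇ 0) ∧ (b ≡ᵇ 2))} x
  ...   | inj₁ w = let (p , q) = ∧≡true⇒× {left} w ; (r , t) = ∧≡true⇒× {a ≡ᵇ 0} q in
                   inj₂ (inj₁ (p , ≡ᵇ≡true⇒≡ a 0 r , ≡ᵇ≡true⇒≡ b 2 t))
  ...   | inj₂ w = let (p , q) = ∧≡true⇒× {right} w ; (r , t) = ∧≡true⇒× {a ≡ᵇ K2} q in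
                   inj₂ (inj₂ (p , ≡ᵇ≡true⇒≡ a K2 r , ≡ᵇ≡true⇒≡ b K4 t))

  c33Edges-path : ∀ path left right a → path a ≡ true → c33Edges path left right a (suc a) ≡ true
  c33Edges-path path left right a e = ∨≡trueˡ _ (×⇒∧≡true (≡⇒≡ᵇ≡true (suc a) (suc a) refl) e)

  c33Edges-leftChord : ∀ path right → c33Edges path true right 0 2 ≡ true
  c33Edges-leftChord path right = ∨≡trueʳ ((2 ≡ᵇ 1) ∧ path 0) (∨≡trueˡ (right ∧ ((0 ≡ᵇ K2) ∧ (2 ≡ᵇ K4))) refl)

  c33Edges-rightChord : ∀ path left → c33Edges path left true K2 K4 ≡ true
  c33Edges-rightChord path left =
    ∨≡trueʳ ((K4 ≡ᵇ suc K2) ∧ path K2)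
            (∨≡trueʳ (left ∧ ((K2 ≡ᵇ 0) ∧ (K4 ≡ᵇ 2))) (×⇒∧≡true (≡⇒≡ᵇ≡true K2 K2 refl) (≡⇒≡ᵇ≡true K4 K4 refl)))

  c33Edges-cong : ∀ path path′ left right → (∀ j → path j ≡ path′ j) → ∀ a b →
    c33Edges path left right a b ≡ c33Edges path′ left right a b
  c33Edges-cong path path′ left right same a b rewrite same a = refl

  c33Edges-pathBit : ∀ path left right j → c33Edges path left right j (suc j) ≡ path j
  c33Edges-pathBit path left right j = ≡true-ext fromEdge (c33Edges-path path left right j)
    where
    fromEdge : c33Edges path left right j (suc j) ≡ true → path j ≡ true
    fromEdge e with c33Edges≡true⇒ path left right j (suc j) e
    ... | inj₁ (_ , pj) = pj
    ... | inj₂ (inj₁ (_ , refl , ()))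
    ... | inj₂ (inj₂ (_ , refl , ()))

  c33Edges-leftChordBit : ∀ path left right → c33Edges path left right 0 2 ≡ left
  c33Edges-leftChordBit path left right = ≡true-ext fromEdge (λ { refl → c33Edges-leftChord path right })
    where
    fromEdge : c33Edges path left right 0 2 ≡ true → left ≡ true
    fromEdge e with c33Edges≡true⇒ path left right 0 2 e
    ... | inj₁ (() , _)
    ... | inj₂ (inj₁ (l , _)) = l
    ... | inj₂ (inj₂ (_ , () , _))

  c33Edges-rightChordBit : ∀ path left right → c33Edges path left right K2 K4 ≡ right
  c33Edges-rightChordBit path left right = ≡true-ext fromEdge (λ { refl → c33Edges-rightChord path left })
    where
    fromEdge : c33Edges path left right K2 K4 ≡ true → right ≡ true
    fromEdge e with c33Edges≡true⇒ path left right K2 K4 e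
    ... | inj₁ (K4≡K3 , _) = ⊥-elim (<-irrefl (sym K4≡K3) (n<1+n K3))
    ... | inj₂ (inj₁ (_ , () , _))
    ... | inj₂ (inj₂ (r , _)) = r

  data Shape : Set where
    mkShape : Triangle → Maybe (ℕ × ℕ) → Triangle → Shape

  -- The guard t < k keeps the path bits of every shape, valid or not, inside the graph.
  middleBits : Maybe (ℕ × ℕ) → ℕ → Bool
  middleBits nothing t = false
  middleBits (just (s , e)) t = inInterval s e t ∧ (t <ᵇ k)

  pathOf : Shape → ℕ → Bool
  pathOf (mkShape A md B) zero = far A
  pathOf (mkShape A md B) (suc zero) = near A
  pathOf (mkShape A md B) (suc (suc t)) = middleBits md t ∨ (((t ≡ᵇ k) ∧ near B) ∨ ((t ≡ᵇ suc k) ∧ far B))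

  leftChordOf rightChordOf : Shape → Bool
  leftChordOf (mkShape A _ _) = chord A
  rightChordOf (mkShape _ _ B) = chord B

  edgesOf : Shape → ℕ → ℕ → Bool
  edgesOf σ = c33Edges (pathOf σ) (leftChordOf σ) (rightChordOf σ)

  middleBits-range : ∀ md t → middleBits md t ≡ true → t < k
  middleBits-range (just (s , e)) t x = <ᵇ≡true⇒< t k (proj₂ (∧≡true⇒× {inInterval s e t} x))

  middleBits-out : ∀ md t → k ≤ t → middleBits md t ≡ false
  middleBits-out nothing t _ = refl
  middleBits-out (just (s , e)) t k≤t rewrite ≥⇒<ᵇ≡false t k k≤t = ∧-zeroʳ _

  middleBits-inInterval : ∀ s e t → t < k → middleBits (just (s , e)) t ≡ inInterval s e t
  middleBits-inInterval s e t t<k rewrite <⇒<ᵇ≡true t<k = ∧-identityʳ _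

  middleBits-start : ∀ s e → s ≤ e → e < k → middleBits (just (s , e)) s ≡ true
  middleBits-start s e s≤e e<k = trans (middleBits-inInterval s e s (≤-<-trans s≤e e<k)) (inInterval≡true ≤-refl s≤e)

  pathOf-range : ∀ σ j → pathOf σ j ≡ true → j < K4
  pathOf-range (mkShape A md B) zero _ = s≤s z≤n
  pathOf-range (mkShape A md B) (suc zero) _ = s≤s (s≤s z≤n)
  pathOf-range (mkShape A md B) (suc (suc t)) x with ∨≡true⇒⊎ {middleBits md t} x
  ... | inj₁ mt = s≤s (s≤s (m<n⇒m<1+n (m<n⇒m<1+n (middleBits-range md t mt))))
  ... | inj₂ x′ with ∨≡true⇒⊎ {(t ≡ᵇ k) ∧ near B} x′
  ...   | inj₁ u rewrite ≡ᵇ≡true⇒≡ t k (proj₁ (∧≡true⇒× {t ≡ᵇ k} u)) = ≤-trans (n<1+n K2) (n≤1+n K3)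
  ...   | inj₂ u rewrite ≡ᵇ≡true⇒≡ t (suc k) (proj₁ (∧≡true⇒× {t ≡ᵇ suc k} u)) = ≤-refl

  pathOf-middle : ∀ A md B t → t < k → pathOf (mkShape A md B) (suc (suc t)) ≡ middleBits md t
  pathOf-middle A md B t t<k
    rewrite ≢⇒≡ᵇ≡false t k (λ t≡k → <-irrefl t≡k t<k)
          | ≢⇒≡ᵇ≡false t (suc k) (λ t≡1+k → <-irrefl t≡1+k (m<n⇒m<1+n t<k))
    = ∨-identityʳ _

  pathOf-K2 : ∀ A md B → pathOf (mkShape A md B) K2 ≡ near B
  pathOf-K2 A md B
    rewrite middleBits-out md k ≤-refl | ≡⇒≡ᵇ≡true k k refl
          | ≢⇒≡ᵇ≡false k (suc k) (λ k≡1+k → <-irrefl k≡1+k (n<1+n k))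
    = ∨-identityʳ _

  pathOf-K3 : ∀ A md B → pathOf (mkShape A md B) K3 ≡ far B
  pathOf-K3 A md B
    rewrite middleBits-out md (suc k) (n≤1+n k) | ≢⇒≡ᵇ≡false (suc k) k (λ 1+k≡k → <-irrefl (sym 1+k≡k) (n<1+n k))
          | ≡⇒≡ᵇ≡true (suc k) (suc k) refl
    = refl

  pathOf-out : ∀ σ j → K4 ≤ j → pathOf σ j ≡ false
  pathOf-out σ j K4≤j with pathOf σ j in e
  ... | false = refl
  ... | true = ⊥-elim (<⇒≱ (pathOf-range σ j e) K4≤j)

  LeftOnly RightOnly MiddleOnly LeftMiddle MiddleRight Through : Shape → Set
  LeftOnly σ = Σ Triangle λ A → anyEdge A ≡ true × mkShape A nothing noEdges ≡ σ
  RightOnly σ = Σ Triangle λ B → anyEdge B ≡ true × mkShape noEdges nothing B ≡ σ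
  MiddleOnly σ = Σ (ℕ × ℕ) λ (s , e) → Interval k (s , e) × mkShape noEdges (just (s , e)) noEdges ≡ σ
  LeftMiddle σ = Σ (Triangle × ℕ) λ (A , e) → (atJoint A ≡ true × e < k) × mkShape A (just (0 , e)) noEdges ≡ σ
  MiddleRight σ = Σ (Triangle × ℕ) λ (B , s) → (atJoint B ≡ true × s < k) × mkShape noEdges (just (s , k')) B ≡ σ
  Through σ = Σ (Triangle × Triangle) λ (A , B) → (atJoint A ≡ true × atJoint B ≡ true) × mkShape A (just (0 , k')) B ≡ σ

  ValidShape : Shape → Set
  ValidShape σ = LeftOnly σ ⊎ (RightOnly σ ⊎ (MiddleOnly σ ⊎ (LeftMiddle σ ⊎ (MiddleRight σ ⊎ Through σ))))

  HasCount-ValidShape : HasCount ValidShape (c33EdgeSets k)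
  HasCount-ValidShape =
    HasCount-⊎ disjoint₁ (HasCount-image (λ A → mkShape A nothing noEdges) (λ { _ _ refl → refl }) HasCount-anyEdge)
    (HasCount-⊎ disjoint₂ (HasCount-image (λ B → mkShape noEdges nothing B) (λ { _ _ refl → refl }) HasCount-anyEdge)
    (HasCount-⊎ disjoint₃ (HasCount-image (λ (s , e) → mkShape noEdges (just (s , e)) noEdges)
                                          (λ { {_ , _} {_ , _} _ _ refl → refl }) (HasCount-Interval k))
    (HasCount-⊎ disjoint₄ (HasCount-image (λ (A , e) → mkShape A (just (0 , e)) noEdges)
                                          (λ { {_ , _} {_ , _} _ _ refl → refl })
                                          (HasCount-× HasCount-atJoint (HasCount-< k)))
    (HasCount-⊎ disjoint₅ (HasCount-image (λ (B , s) → mkShape noEdges (just (s , k')) B)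
                                          (λ { {_ , _} {_ , _} _ _ refl → refl })
                                          (HasCount-× HasCount-atJoint (HasCount-< k)))
                          (HasCount-image (λ (A , B) → mkShape A (just (0 , k')) B)
                                          (λ { {_ , _} {_ , _} _ _ refl → refl })
                                          (HasCount-× HasCount-atJoint HasCount-atJoint))))))
    where
    disjoint₁ : ∀ σ → LeftOnly σ → RightOnly σ ⊎ (MiddleOnly σ ⊎ (LeftMiddle σ ⊎ (MiddleRight σ ⊎ Through σ))) → ⊥
    disjoint₁ _ (_ , () , refl) (inj₁ (_ , _ , refl))
    disjoint₁ _ (_ , _ , refl) (inj₂ (inj₁ (_ , _ , ())))
    disjoint₁ _ (_ , _ , refl) (inj₂ (inj₂ (inj₁ (_ , _ , ()))))
    disjoint₁ _ (_ , _ , refl) (inj₂ (inj₂ (inj₂ (inj₁ (_ , _ , ())))))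
    disjoint₁ _ (_ , _ , refl) (inj₂ (inj₂ (inj₂ (inj₂ (_ , _ , ())))))
    disjoint₂ : ∀ σ → RightOnly σ → MiddleOnly σ ⊎ (LeftMiddle σ ⊎ (MiddleRight σ ⊎ Through σ)) → ⊥
    disjoint₂ _ (_ , _ , refl) (inj₁ (_ , _ , ()))
    disjoint₂ _ (_ , _ , refl) (inj₂ (inj₁ (_ , _ , ())))
    disjoint₂ _ (_ , _ , refl) (inj₂ (inj₂ (inj₁ (_ , _ , ()))))
    disjoint₂ _ (_ , _ , refl) (inj₂ (inj₂ (inj₂ (_ , _ , ()))))
    disjoint₃ : ∀ σ → MiddleOnly σ → LeftMiddle σ ⊎ (MiddleRight σ ⊎ Through σ) → ⊥
    disjoint₃ _ (_ , _ , refl) (inj₁ (_ , (() , _) , refl))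
    disjoint₃ _ (_ , _ , refl) (inj₂ (inj₁ (_ , (() , _) , refl)))
    disjoint₃ _ (_ , _ , refl) (inj₂ (inj₂ (_ , (() , _) , refl)))
    disjoint₄ : ∀ σ → LeftMiddle σ → MiddleRight σ ⊎ Through σ → ⊥
    disjoint₄ _ (_ , (() , _) , refl) (inj₁ (_ , _ , refl))
    disjoint₄ _ (_ , _ , refl) (inj₂ (_ , (_ , ()) , refl))
    disjoint₅ : ∀ σ → MiddleRight σ → Through σ → ⊥
    disjoint₅ _ (_ , _ , refl) (_ , (() , _) , refl)

  edgesOf-isEdgeSet : ∀ σ → ValidShape σ → IsEdgeSet (edgesOf σ)
  edgesOf-isEdgeSet σ _ a b x with c33Edges≡true⇒ (pathOf σ) (leftChordOf σ) (rightChordOf σ) a b x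
  ... | inj₁ (refl , pa) = ≤-refl , s≤s (pathOf-range σ a pa) , inj₁ (refl , s≤s (pathOf-range σ a pa))
  ... | inj₂ (inj₁ (_ , refl , refl)) = s≤s z≤n , s≤s (s≤s (s≤s z≤n)) , inj₂ (inj₁ (refl , refl))
  ... | inj₂ (inj₂ (_ , refl , refl)) = s≤s (s≤s (s≤s (n≤1+n k))) , ≤-refl , inj₂ (inj₂ (refl , refl))

  module Edges (A : Triangle) (md : Maybe (ℕ × ℕ)) (B : Triangle) where
    X : ℕ → ℕ → Bool
    X = edgesOf (mkShape A md B)

    path : ℕ → Bool
    path = pathOf (mkShape A md B)

    edge01 : far A ≡ true → X 0 1 ≡ true
    edge01 = c33Edges-path path (chord A) (chord B) 0
    edge12 : near A ≡ true → X 1 2 ≡ true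
    edge12 = c33Edges-path path (chord A) (chord B) 1
    edge02 : chord A ≡ true → X 0 2 ≡ true
    edge02 h = trans (c33Edges-leftChordBit path (chord A) (chord B)) h
    edgeK2K3 : near B ≡ true → X K2 K3 ≡ true
    edgeK2K3 h = c33Edges-path path (chord A) (chord B) K2 (trans (pathOf-K2 A md B) h)
    edgeK3K4 : far B ≡ true → X K3 K4 ≡ true
    edgeK3K4 h = c33Edges-path path (chord A) (chord B) K3 (trans (pathOf-K3 A md B) h)
    edgeK2K4 : chord B ≡ true → X K2 K4 ≡ true
    edgeK2K4 h = trans (c33Edges-rightChordBit path (chord A) (chord B)) h
    edgeMiddle : ∀ t → middleBits md t ≡ true → X (suc (suc t)) (suc (suc (suc t))) ≡ true
    edgeMiddle t h =
      c33Edges-path path (chord A) (chord B) (suc (suc t)) (trans (pathOf-middle A md B t (middleBits-range md t h)) h)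

    data LowerEnd : ℕ → Set where
      leftFar : far A ≡ true → LowerEnd 0
      leftNear : near A ≡ true → LowerEnd 1
      leftChord : chord A ≡ true → LowerEnd 0
      middle : ∀ t → middleBits md t ≡ true → LowerEnd (suc (suc t))
      rightNear : near B ≡ true → LowerEnd K2
      rightFar : far B ≡ true → LowerEnd K3
      rightChord : chord B ≡ true → LowerEnd K2

    lowerEnd : ∀ a b → X a b ≡ true → LowerEnd a
    lowerEnd a b x with c33Edges≡true⇒ path (chord A) (chord B) a b x
    ... | inj₂ (inj₁ (h , refl , _)) = leftChord h
    ... | inj₂ (inj₂ (h , refl , _)) = rightChord h
    lowerEnd zero b x | inj₁ (_ , h) = leftFar h
    lowerEnd (suc zero) b x | inj₁ (_ , h) = leftNear h
    lowerEnd (suc (suc t)) b x | inj₁ (_ , h) with ∨≡true⇒⊎ {middleBits md t} h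
    ... | inj₁ mt = middle t mt
    ... | inj₂ h′ with ∨≡true⇒⊎ {(t ≡ᵇ k) ∧ near B} h′
    ...   | inj₁ u = let (t≡k , nb) = ∧≡true⇒× {t ≡ᵇ k} u in
                     subst (λ t → LowerEnd (suc (suc t))) (sym (≡ᵇ≡true⇒≡ t k t≡k)) (rightNear nb)
    ...   | inj₂ u = let (t≡1+k , fb) = ∧≡true⇒× {t ≡ᵇ suc k} u in
                     subst (λ t → LowerEnd (suc (suc t))) (sym (≡ᵇ≡true⇒≡ t (suc k) t≡1+k)) (rightFar fb)

    walkBack : ∀ {a b} → X a b ≡ true → Walk X b a
    walkBack x = inj₂ x ∷ []

    walk0to2 : atJoint A ≡ true → far A ≡ true → Walk X 0 2
    walk0to2 joint fa with true-or-false (near A) | true-or-false (chord A)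
    ... | _ | inj₁ ca = Walk-edge (edge02 ca)
    ... | inj₁ na | inj₂ _ = Walk-trans {b = 1} (Walk-edge (edge01 fa)) (Walk-edge (edge12 na))
    ... | inj₂ na | inj₂ ca = ⊥-elim (true≢false (trans (sym joint) (cong₂ _∨_ na ca)))

    walkK3toK2 : atJoint B ≡ true → far B ≡ true → Walk X K3 K2
    walkK3toK2 joint fb with true-or-false (near B) | true-or-false (chord B)
    ... | _ | inj₁ cb = Walk-trans {b = K4} (Walk-edge (edgeK3K4 fb)) (walkBack (edgeK2K4 cb))
    ... | inj₁ nb | inj₂ _ = walkBack (edgeK2K3 nb)
    ... | inj₂ nb | inj₂ cb = ⊥-elim (true≢false (trans (sym joint) (cong₂ _∨_ nb cb)))

  open Edges using (leftFar; leftNear; leftChord; middle; rightNear; rightFar; rightChord)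

  ≢noEdges : ∀ {T} (f : Triangle → Bool) → f T ≡ true → f noEdges ≡ false → T ≢ noEdges
  ≢noEdges f fT f∅ refl = true≢false (trans (sym fT) f∅)

  LeftAttached RightAttached : Triangle → ℕ → Set
  LeftAttached A s = A ≡ noEdges ⊎ (s ≡ 0 × atJoint A ≡ true)
  RightAttached B e = B ≡ noEdges ⊎ (e ≡ k' × atJoint B ≡ true)

  attached : ∀ {T : Triangle} {P : Set} → T ≡ noEdges ⊎ P → T ≢ noEdges → P
  attached (inj₁ T≡∅) T≢∅ = ⊥-elim (T≢∅ T≡∅)
  attached (inj₂ p) _ = p

  nonEmpty-left : ∀ A md B → anyEdge A ≡ true → NonEmpty (edgesOf (mkShape A md B))
  nonEmpty-left A@(true , _ , _) md B _ = 0 , 1 , Edges.edge01 A md B refl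
  nonEmpty-left A@(false , true , _) md B _ = 1 , 2 , Edges.edge12 A md B refl
  nonEmpty-left A@(false , false , true) md B _ = 0 , 2 , Edges.edge02 A md B refl

  nonEmpty-right : ∀ A md B → anyEdge B ≡ true → NonEmpty (edgesOf (mkShape A md B))
  nonEmpty-right A md B@(true , _ , _) _ = K3 , K4 , Edges.edgeK3K4 A md B refl
  nonEmpty-right A md B@(false , true , _) _ = K2 , K3 , Edges.edgeK2K3 A md B refl
  nonEmpty-right A md B@(false , false , true) _ = K2 , K4 , Edges.edgeK2K4 A md B refl

  nonEmpty-middle : ∀ A s e B → s ≤ e → e < k → NonEmpty (edgesOf (mkShape A (just (s , e)) B))
  nonEmpty-middle A s e B s≤e e<k = suc (suc s) , suc (suc (suc s)) ,
    Edges.edgeMiddle A (just (s , e)) B s (middleBits-start s e s≤e e<k)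

  edgesOf-nonEmpty : ∀ σ → ValidShape σ → NonEmpty (edgesOf σ)
  edgesOf-nonEmpty _ (inj₁ (A , nonEmpty , refl)) = nonEmpty-left A nothing noEdges nonEmpty
  edgesOf-nonEmpty _ (inj₂ (inj₁ (B , nonEmpty , refl))) = nonEmpty-right noEdges nothing B nonEmpty
  edgesOf-nonEmpty _ (inj₂ (inj₂ (inj₁ ((s , e) , (s≤e , e<k) , refl)))) = nonEmpty-middle noEdges s e noEdges s≤e e<k
  edgesOf-nonEmpty _ (inj₂ (inj₂ (inj₂ (inj₁ ((A , e) , (_ , e<k) , refl))))) = nonEmpty-middle A 0 e noEdges z≤n e<k
  edgesOf-nonEmpty _ (inj₂ (inj₂ (inj₂ (inj₂ (inj₁ ((B , s) , (_ , s<k) , refl)))))) =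
    nonEmpty-middle noEdges s k' B (≤-pred s<k) ≤-refl
  edgesOf-nonEmpty _ (inj₂ (inj₂ (inj₂ (inj₂ (inj₂ ((A , B) , _ , refl)))))) = nonEmpty-middle A 0 k' B z≤n ≤-refl

  rooted-left : ∀ A → anyEdge A ≡ true → Rooted (edgesOf (mkShape A nothing noEdges))
  rooted-left A nonEmpty with atJoint A in joint
  ... | true = 2 , λ a b x → toJoint (lowerEnd a b x)
    where
    open Edges A nothing noEdges
    toJoint : ∀ {a} → LowerEnd a → Walk X a 2
    toJoint (leftFar h) = walk0to2 joint h
    toJoint (leftNear h) = Walk-edge (edge12 h)
    toJoint (leftChord h) = Walk-edge (edge02 h)
    toJoint (middle _ ())
    toJoint (rightNear ())
    toJoint (rightFar ())
    toJoint (rightChord ())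
  ... | false = 0 , λ a b x → toZero (lowerEnd a b x)
    where
    open Edges A nothing noEdges
    toZero : ∀ {a} → LowerEnd a → Walk X a 0
    toZero (leftFar _) = []
    toZero (leftNear h) = ⊥-elim (true≢false (trans (sym (∨≡trueˡ (chord A) h)) joint))
    toZero (leftChord h) = ⊥-elim (true≢false (trans (sym (∨≡trueʳ (near A) h)) joint))
    toZero (middle _ ())
    toZero (rightNear ())
    toZero (rightFar ())
    toZero (rightChord ())

  rooted-right : ∀ B → anyEdge B ≡ true → Rooted (edgesOf (mkShape noEdges nothing B))
  rooted-right B nonEmpty with atJoint B in joint
  ... | true = K2 , λ a b x → toJoint (lowerEnd a b x)
    where
    open Edges noEdges nothing B
    toJoint : ∀ {a} → LowerEnd a → Walk X a K2
    toJoint (leftFar ())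
    toJoint (leftNear ())
    toJoint (leftChord ())
    toJoint (middle _ ())
    toJoint (rightNear _) = []
    toJoint (rightFar h) = walkK3toK2 joint h
    toJoint (rightChord _) = []
  ... | false = K3 , λ a b x → toK3 (lowerEnd a b x)
    where
    open Edges noEdges nothing B
    toK3 : ∀ {a} → LowerEnd a → Walk X a K3
    toK3 (leftFar ())
    toK3 (leftNear ())
    toK3 (leftChord ())
    toK3 (middle _ ())
    toK3 (rightNear h) = ⊥-elim (true≢false (trans (sym (∨≡trueˡ (chord B) h)) joint))
    toK3 (rightFar _) = []
    toK3 (rightChord h) = ⊥-elim (true≢false (trans (sym (∨≡trueʳ (near B) h)) joint))

  rooted-middle : ∀ A s e B → s ≤ e → e < k → LeftAttached A s → RightAttached B e →
    Rooted (edgesOf (mkShape A (just (s , e)) B))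
  rooted-middle A s e B s≤e e<k leftAttached rightAttached = suc (suc s) , λ a b x → toStart (lowerEnd a b x)
    where
    open Edges A (just (s , e)) B
    onMiddle : ∀ l → suc (suc s) ≤ l → l ≤ suc (suc e) → path l ≡ true
    onMiddle (suc (suc t)) (s≤s (s≤s s≤t)) (s≤s (s≤s t≤e)) =
      trans (pathOf-middle A (just (s , e)) B t t<k) (trans (middleBits-inInterval s e t t<k) (inInterval≡true s≤t t≤e))
      where
      t<k = ≤-<-trans t≤e e<k
    fromStart : ∀ t → s ≤ t → t ≤ suc e → Walk X (suc (suc s)) (suc (suc t))
    fromStart t s≤t t≤1+e = Walk-consecutive X _ _ (s≤s (s≤s s≤t)) λ l 2+s≤l l<2+t →
      c33Edges-path path (chord A) (chord B) l (onMiddle l 2+s≤l (≤-trans (m<1+n⇒m≤n l<2+t) (s≤s t≤1+e)))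
    fromK2 : e ≡ k' → Walk X K2 (suc (suc s))
    fromK2 e≡k′ = Walk-sym (subst (λ e → Walk X (suc (suc s)) (suc (suc (suc e)))) e≡k′
                                  (fromStart (suc e) (m≤n⇒m≤1+n s≤e) ≤-refl))
    toStart : ∀ {a} → LowerEnd a → Walk X a (suc (suc s))
    toStart (middle t mt) =
      let t<k = middleBits-range (just (s , e)) t mt
          (s≤t , t≤e) = inInterval≡true⇒ s e t (trans (sym (middleBits-inInterval s e t t<k)) mt) in
      Walk-sym (fromStart t s≤t (m≤n⇒m≤1+n t≤e))
    toStart (leftFar h) = let (s≡0 , joint) = attached leftAttached (≢noEdges far h refl) in
      subst (λ s → Walk X 0 (suc (suc s))) (sym s≡0) (walk0to2 joint h)
    toStart (leftNear h) = let (s≡0 , _) = attached leftAttached (≢noEdges near h refl) in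
      subst (λ s → Walk X 1 (suc (suc s))) (sym s≡0) (Walk-edge (edge12 h))
    toStart (leftChord h) = let (s≡0 , _) = attached leftAttached (≢noEdges chord h refl) in
      subst (λ s → Walk X 0 (suc (suc s))) (sym s≡0) (Walk-edge (edge02 h))
    toStart (rightNear h) = fromK2 (proj₁ (attached rightAttached (≢noEdges near h refl)))
    toStart (rightChord h) = fromK2 (proj₁ (attached rightAttached (≢noEdges chord h refl)))
    toStart (rightFar h) = let (e≡k′ , joint) = attached rightAttached (≢noEdges far h refl) in
      Walk-trans (walkK3toK2 joint h) (fromK2 e≡k′)

  edgesOf-rooted : ∀ σ → ValidShape σ → Rooted (edgesOf σ)
  edgesOf-rooted _ (inj₁ (A , nonEmpty , refl)) = rooted-left A nonEmpty
  edgesOf-rooted _ (inj₂ (inj₁ (B , nonEmpty , refl))) = rooted-right B nonEmpty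
  edgesOf-rooted _ (inj₂ (inj₂ (inj₁ ((s , e) , (s≤e , e<k) , refl)))) =
    rooted-middle noEdges s e noEdges s≤e e<k (inj₁ refl) (inj₁ refl)
  edgesOf-rooted _ (inj₂ (inj₂ (inj₂ (inj₁ ((A , e) , (joint , e<k) , refl))))) =
    rooted-middle A 0 e noEdges z≤n e<k (inj₂ (refl , joint)) (inj₁ refl)
  edgesOf-rooted _ (inj₂ (inj₂ (inj₂ (inj₂ (inj₁ ((B , s) , (joint , s<k) , refl)))))) =
    rooted-middle noEdges s k' B (≤-pred s<k) ≤-refl (inj₁ refl) (inj₂ (refl , joint))
  edgesOf-rooted _ (inj₂ (inj₂ (inj₂ (inj₂ (inj₂ ((A , B) , (jointA , jointB) , refl)))))) =
    rooted-middle A 0 k' B z≤n ≤-refl (inj₂ (refl , jointA)) (inj₂ (refl , jointB))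

  ValidMiddle : Maybe (ℕ × ℕ) → Set
  ValidMiddle nothing = ⊤
  ValidMiddle (just (s , e)) = Interval k (s , e)

  middleOf : Shape → Maybe (ℕ × ℕ)
  middleOf (mkShape _ md _) = md

  middleOf-valid : ∀ σ → ValidShape σ → ValidMiddle (middleOf σ)
  middleOf-valid _ (inj₁ (_ , _ , refl)) = tt
  middleOf-valid _ (inj₂ (inj₁ (_ , _ , refl))) = tt
  middleOf-valid _ (inj₂ (inj₂ (inj₁ (_ , I , refl)))) = I
  middleOf-valid _ (inj₂ (inj₂ (inj₂ (inj₁ (_ , (_ , e<k) , refl))))) = z≤n , e<k
  middleOf-valid _ (inj₂ (inj₂ (inj₂ (inj₂ (inj₁ (_ , (_ , s<k) , refl)))))) = ≤-pred s<k , ≤-refl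
  middleOf-valid _ (inj₂ (inj₂ (inj₂ (inj₂ (inj₂ (_ , _ , refl)))))) = z≤n , ≤-refl

  Triangle-ext : ∀ {A A′ : Triangle} → far A ≡ far A′ → near A ≡ near A′ → chord A ≡ chord A′ → A ≡ A′
  Triangle-ext {_ , _ , _} {_ , _ , _} refl refl refl = refl

  middleBits-injective : ∀ md md′ → ValidMiddle md → ValidMiddle md′ →
    (∀ t → t < k → middleBits md t ≡ middleBits md′ t) → md ≡ md′
  middleBits-injective nothing nothing _ _ _ = refl
  middleBits-injective (just (s , e)) (just (s′ , e′)) I I′ same =
    cong just (inInterval-injective I I′ λ t t<k →
      trans (sym (middleBits-inInterval s e t t<k)) (trans (same t t<k) (middleBits-inInterval s′ e′ t t<k)))
  middleBits-injective nothing (just (s , e)) _ (s≤e , e<k) same =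
    ⊥-elim (true≢false (trans (sym (middleBits-start s e s≤e e<k)) (sym (same s (≤-<-trans s≤e e<k)))))
  middleBits-injective (just (s , e)) nothing (s≤e , e<k) _ same =
    ⊥-elim (true≢false (trans (sym (middleBits-start s e s≤e e<k)) (same s (≤-<-trans s≤e e<k))))

  edgesOf-injective : ∀ σ τ → ValidShape σ → ValidShape τ → (∀ a b → edgesOf σ a b ≡ edgesOf τ a b) → σ ≡ τ
  edgesOf-injective σ τ vσ vτ same =
    fromParts σ τ (middleOf-valid σ vσ) (middleOf-valid τ vτ) samePath sameLeft sameRight
    where
    samePath : ∀ l → pathOf σ l ≡ pathOf τ l
    samePath l = trans (sym (c33Edges-pathBit (pathOf σ) (leftChordOf σ) (rightChordOf σ) l))
                       (trans (same l (suc l)) (c33Edges-pathBit (pathOf τ) (leftChordOf τ) (rightChordOf τ) l))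
    sameLeft : leftChordOf σ ≡ leftChordOf τ
    sameLeft = trans (sym (c33Edges-leftChordBit (pathOf σ) (leftChordOf σ) (rightChordOf σ)))
                     (trans (same 0 2) (c33Edges-leftChordBit (pathOf τ) (leftChordOf τ) (rightChordOf τ)))
    sameRight : rightChordOf σ ≡ rightChordOf τ
    sameRight = trans (sym (c33Edges-rightChordBit (pathOf σ) (leftChordOf σ) (rightChordOf σ)))
                      (trans (same K2 K4) (c33Edges-rightChordBit (pathOf τ) (leftChordOf τ) (rightChordOf τ)))
    fromParts : ∀ σ τ → ValidMiddle (middleOf σ) → ValidMiddle (middleOf τ) → (∀ l → pathOf σ l ≡ pathOf τ l) →
      leftChordOf σ ≡ leftChordOf τ → rightChordOf σ ≡ rightChordOf τ → σ ≡ τ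
    fromParts (mkShape A md B) (mkShape A′ md′ B′) I I′ path left right =
      cong₃ (Triangle-ext (path 0) (path 1) left)
            (middleBits-injective md md′ I I′ λ t t<k →
               trans (sym (pathOf-middle A md B t t<k)) (trans (path (suc (suc t))) (pathOf-middle A′ md′ B′ t t<k)))
            (Triangle-ext (trans (sym (pathOf-K3 A md B)) (trans (path K3) (pathOf-K3 A′ md′ B′)))
                          (trans (sym (pathOf-K2 A md B)) (trans (path K2) (pathOf-K2 A′ md′ B′))) right)
      where
      cong₃ : ∀ {A A′ md md′ B B′} → A ≡ A′ → md ≡ md′ → B ≡ B′ → mkShape A md B ≡ mkShape A′ md′ B′
      cong₃ refl refl refl = refl

  anyEdge≡false⇒noEdges : ∀ T → anyEdge T ≡ false → T ≡ noEdges
  anyEdge≡false⇒noEdges (false , false , false) _ = refl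

  farOnly : ∀ T → anyEdge T ≡ true → atJoint T ≡ false → far T ≡ true
  farOnly (true , _ , _) _ _ = refl
  farOnly (false , r , c) rc≡true rc≡false = ⊥-elim (true≢false (trans (sym rc≡true) rc≡false))

  pathOf-empty : ∀ j → pathOf (mkShape noEdges nothing noEdges) j ≡ false
  pathOf-empty zero = refl
  pathOf-empty (suc zero) = refl
  pathOf-empty (suc (suc t)) rewrite ∧-zeroʳ (t ≡ᵇ k) | ∧-zeroʳ (t ≡ᵇ suc k) = refl

  edgesOf-empty : ∀ a b → edgesOf (mkShape noEdges nothing noEdges) a b ≡ false
  edgesOf-empty a b rewrite pathOf-empty a | ∧-zeroʳ (b ≡ᵇ suc a) = refl

  validShape-noMiddle : ∀ A B → (anyEdge A ≡ true × B ≡ noEdges) ⊎ (A ≡ noEdges × anyEdge B ≡ true) →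
    ValidShape (mkShape A nothing B)
  validShape-noMiddle A B (inj₁ (nonEmpty , refl)) = inj₁ (A , nonEmpty , refl)
  validShape-noMiddle A B (inj₂ (refl , nonEmpty)) = inj₂ (inj₁ (B , nonEmpty , refl))

  validShape-middle : ∀ A B s e → Interval k (s , e) → LeftAttached A s → RightAttached B e →
    ValidShape (mkShape A (just (s , e)) B)
  validShape-middle A B s e I (inj₁ refl) (inj₁ refl) = inj₂ (inj₂ (inj₁ ((s , e) , I , refl)))
  validShape-middle A B s e (_ , e<k) (inj₂ (refl , jointA)) (inj₁ refl) =
    inj₂ (inj₂ (inj₂ (inj₁ ((A , e) , (jointA , e<k) , refl))))
  validShape-middle A B s e (s≤e , e<k) (inj₁ refl) (inj₂ (refl , jointB)) =
    inj₂ (inj₂ (inj₂ (inj₂ (inj₁ ((B , s) , (jointB , ≤-<-trans s≤e e<k) , refl)))))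
  validShape-middle A B s e _ (inj₂ (refl , jointA)) (inj₂ (refl , jointB)) =
    inj₂ (inj₂ (inj₂ (inj₂ (inj₂ ((A , B) , (jointA , jointB) , refl)))))

  module _ {V : Vec Bool n} {M : Vec (Vec Bool n) n} (C : IsConnSub G (V , M)) where

    pathBits : ℕ → Bool
    pathBits j = entry M j (suc j)

    leftChordBit rightChordBit : Bool
    leftChordBit = entry M 0 2
    rightChordBit = entry M K2 K4

    entry≡c33Edges : ∀ a b → entry M a b ≡ c33Edges pathBits leftChordBit rightChordBit a b
    entry≡c33Edges a b = ≡true-ext fromEntry toEntry
      where
      fromEntry : entry M a b ≡ true → c33Edges pathBits leftChordBit rightChordBit a b ≡ true
      fromEntry x with IsConnSub-edge C a b x
      ... | _ , _ , inj₁ (inj₁ (refl , _)) , _ = c33Edges-path pathBits leftChordBit rightChordBit a x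
      ... | _ , _ , inj₁ (inj₂ (inj₁ (refl , refl))) , _ = trans (c33Edges-leftChordBit pathBits leftChordBit rightChordBit) x
      ... | _ , _ , inj₁ (inj₂ (inj₂ (refl , refl))) , _ = trans (c33Edges-rightChordBit pathBits leftChordBit rightChordBit) x
      ... | a<b , _ , inj₂ (inj₁ (refl , _)) , _ = ⊥-elim (<-asym a<b ≤-refl)
      ... | a<b , _ , inj₂ (inj₂ (inj₁ (refl , _))) , _ = ⊥-elim (<-irrefl refl (≤-<-trans z≤n a<b))
      ... | a<b , _ , inj₂ (inj₂ (inj₂ (refl , refl))) , _ = ⊥-elim (<-asym a<b (<-trans (n<1+n K2) (n<1+n K3)))
      toEntry : c33Edges pathBits leftChordBit rightChordBit a b ≡ true → entry M a b ≡ true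
      toEntry x with c33Edges≡true⇒ pathBits leftChordBit rightChordBit a b x
      ... | inj₁ (refl , pa) = pa
      ... | inj₂ (inj₁ (l , refl , refl)) = l
      ... | inj₂ (inj₂ (r , refl , refl)) = r

    InV : ℕ → Set
    InV v = lookupℕ V v false ≡ true

    pathBit-ends : ∀ j → pathBits j ≡ true → InV j × InV (suc j)
    pathBit-ends j x = let (_ , _ , _ , Vj , V1+j) = IsConnSub-edge C j (suc j) x in Vj , V1+j

    separated : ∀ c → pathBits c ≡ false → (leftChordBit ≡ false ⊎ 2 ≤ c) → (rightChordBit ≡ false ⊎ c < K2) →
      ∀ u v → u ≤ c → c < v → v < n → InV u → InV v → ⊥
    separated c noPathEdge leftUncut rightUncut u v u≤c c<v v<n Vu Vv = true≢false (begin
      true        ≡⟨ ≤⇒≤ᵇ≡true u≤c ⟨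
      (u ≤ᵇ c)    ≡⟨ IsConnSub-cut C (_≤ᵇ c) respects u v (≤-<-trans u≤c (<-trans c<v v<n)) v<n Vu Vv ⟩
      (v ≤ᵇ c)    ≡⟨ >⇒≤ᵇ≡false v c c<v ⟩
      false       ∎)
      where
      open ≡-Reasoning
      leftSide : leftChordBit ≡ true → leftChordBit ≡ false ⊎ 2 ≤ c → (0 ≤ᵇ c) ≡ (2 ≤ᵇ c)
      leftSide l (inj₁ noChord) = ⊥-elim (true≢false (trans (sym l) noChord))
      leftSide l (inj₂ 2≤c) = sym (≤⇒≤ᵇ≡true 2≤c)
      rightSide : rightChordBit ≡ true → rightChordBit ≡ false ⊎ c < K2 → (K2 ≤ᵇ c) ≡ (K4 ≤ᵇ c)
      rightSide r (inj₁ noChord) = ⊥-elim (true≢false (trans (sym r) noChord))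
      rightSide r (inj₂ c<K2) =
        trans (>⇒≤ᵇ≡false K2 c c<K2) (sym (>⇒≤ᵇ≡false K4 c (<-trans c<K2 (<-trans (n<1+n K2) (n<1+n K3)))))
      respects : ∀ a b → entry M a b ≡ true → (a ≤ᵇ c) ≡ (b ≤ᵇ c)
      respects a b x with c33Edges≡true⇒ pathBits leftChordBit rightChordBit a b (trans (sym (entry≡c33Edges a b)) x)
      ... | inj₁ (refl , pa) = ≤ᵇ-step c a (λ { refl → true≢false (trans (sym pa) noPathEdge) })
      ... | inj₂ (inj₁ (l , refl , refl)) = leftSide l leftUncut
      ... | inj₂ (inj₂ (r , refl , refl)) = rightSide r rightUncut

    middlePath : ℕ → Bool
    middlePath t = pathBits (suc (suc t))

    noGap-middle : NoGap middlePath k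
    noGap-middle a c b a<c c<b b<k ma mc mb =
      separated (suc (suc c)) mc (inj₂ (s≤s (s≤s z≤n))) (inj₂ (s≤s (s≤s (<-trans c<b b<k))))
        (suc (suc a)) (suc (suc (suc b))) (s≤s (s≤s (<⇒≤ a<c))) (s≤s (s≤s (m<n⇒m<1+n c<b)))
        (s≤s (s≤s (s≤s (m<n⇒m<1+n (m<n⇒m<1+n b<k)))))
        (proj₁ (pathBit-ends (suc (suc a)) ma)) (proj₂ (pathBit-ends (suc (suc b)) mb))

    leftTriangle rightTriangle : Triangle
    leftTriangle = pathBits 0 , pathBits 1 , leftChordBit
    rightTriangle = pathBits K3 , pathBits K2 , rightChordBit

    leftVertex : anyEdge leftTriangle ≡ true → Σ ℕ λ u → u ≤ 1 × InV u
    leftVertex x with ∨≡true⇒⊎ {pathBits 0} x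
    ... | inj₁ f = 0 , z≤n , proj₁ (pathBit-ends 0 f)
    ... | inj₂ x′ with ∨≡true⇒⊎ {pathBits 1} x′
    ...   | inj₁ r = 1 , ≤-refl , proj₁ (pathBit-ends 1 r)
    ...   | inj₂ c = 0 , z≤n , proj₁ (proj₂ (proj₂ (proj₂ (IsConnSub-edge C 0 2 c))))

    rightVertex : anyEdge rightTriangle ≡ true → Σ ℕ λ v → K3 ≤ v × v < n × InV v
    rightVertex x with ∨≡true⇒⊎ {pathBits K3} x
    ... | inj₁ f = K4 , n≤1+n K3 , ≤-refl , proj₂ (pathBit-ends K3 f)
    ... | inj₂ x′ with ∨≡true⇒⊎ {pathBits K2} x′
    ...   | inj₁ r = K3 , ≤-refl , m<n⇒m<1+n (n<1+n K3) , proj₂ (pathBit-ends K2 r)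
    ...   | inj₂ c = K4 , n≤1+n K3 , ≤-refl , proj₂ (proj₂ (proj₂ (proj₂ (IsConnSub-edge C K2 K4 c))))

    entry≡edgesOf : ∀ md → (∀ t → t < k → middlePath t ≡ middleBits md t) →
      ∀ a b → entry M a b ≡ edgesOf (mkShape leftTriangle md rightTriangle) a b
    entry≡edgesOf md sameMiddle a b =
      trans (entry≡c33Edges a b) (c33Edges-cong pathBits (pathOf σ) leftChordBit rightChordBit samePath a b)
      where
      σ = mkShape leftTriangle md rightTriangle
      samePath : ∀ j → pathBits j ≡ pathOf σ j
      samePath zero = refl
      samePath (suc zero) = refl
      samePath (suc (suc t)) with <-cmp t k
      ... | tri< t<k _ _ = trans (sameMiddle t t<k) (sym (pathOf-middle leftTriangle md rightTriangle t t<k))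
      ... | tri≈ _ refl _ = sym (pathOf-K2 leftTriangle md rightTriangle)
      ... | tri> _ _ k<t with m≤n⇒m<n∨m≡n k<t
      ...   | inj₂ refl = sym (pathOf-K3 leftTriangle md rightTriangle)
      ...   | inj₁ 1+k<t = trans (entry-outʳ M (suc (suc t)) (suc (suc (suc t))) (s≤s (s≤s (s≤s 1+k<t))))
                                 (sym (pathOf-out σ (suc (suc t)) (s≤s (s≤s 1+k<t))))

    MatchingShape : Set
    MatchingShape = Σ Shape λ σ → ValidShape σ × (∀ a b → entry M a b ≡ edgesOf σ a b)

    shapeWithoutMiddle : ∀ a b → entry M a b ≡ true → AllFalse middlePath k → MatchingShape
    shapeWithoutMiddle a b Mab noMiddle =
      mkShape leftTriangle nothing rightTriangle ,
      validShape-noMiddle leftTriangle rightTriangle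
        (exactlyOne (true-or-false (anyEdge leftTriangle)) (true-or-false (anyEdge rightTriangle))) ,
      entry≡edgesOf nothing noMiddle
      where
      notBoth : anyEdge leftTriangle ≡ true → anyEdge rightTriangle ≡ true → ⊥
      notBoth nonEmptyˡ nonEmptyʳ =
        let (u , u≤1 , Vu) = leftVertex nonEmptyˡ ; (v , K3≤v , v<n , Vv) = rightVertex nonEmptyʳ in
        separated 2 (noMiddle 0 (s≤s z≤n)) (inj₂ ≤-refl) (inj₂ (s≤s (s≤s (s≤s z≤n))))
          u v (m≤n⇒m≤1+n u≤1) (<-≤-trans (s≤s (s≤s (s≤s z≤n))) K3≤v) v<n Vu Vv
      notNeither : leftTriangle ≡ noEdges → rightTriangle ≡ noEdges → ⊥
      notNeither left∅ right∅ = true≢false (begin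
        true                                                        ≡⟨ Mab ⟨
        entry M a b                                                 ≡⟨ entry≡edgesOf nothing noMiddle a b ⟩
        edgesOf (mkShape leftTriangle nothing rightTriangle) a b
          ≡⟨ cong₂ (λ A B → edgesOf (mkShape A nothing B) a b) left∅ right∅ ⟩
        edgesOf (mkShape noEdges nothing noEdges) a b               ≡⟨ edgesOf-empty a b ⟩
        false                                                       ∎)
        where open ≡-Reasoning
      exactlyOne : anyEdge leftTriangle ≡ true ⊎ anyEdge leftTriangle ≡ false →
                   anyEdge rightTriangle ≡ true ⊎ anyEdge rightTriangle ≡ false →
        (anyEdge leftTriangle ≡ true × rightTriangle ≡ noEdges) ⊎ (leftTriangle ≡ noEdges × anyEdge rightTriangle ≡ true)
      exactlyOne (inj₁ l) (inj₁ r) = ⊥-elim (notBoth l r)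
      exactlyOne (inj₁ l) (inj₂ r) = inj₁ (l , anyEdge≡false⇒noEdges _ r)
      exactlyOne (inj₂ l) (inj₁ r) = inj₂ (anyEdge≡false⇒noEdges _ l , r)
      exactlyOne (inj₂ l) (inj₂ r) = ⊥-elim (notNeither (anyEdge≡false⇒noEdges _ l) (anyEdge≡false⇒noEdges _ r))

    shapeWithMiddle : ∀ s e → Interval k (s , e) → (∀ t → t < k → middlePath t ≡ inInterval s e t) → MatchingShape
    shapeWithMiddle s e (s≤e , e<k) onMiddle =
      mkShape leftTriangle (just (s , e)) rightTriangle ,
      validShape-middle leftTriangle rightTriangle s e (s≤e , e<k) leftAttached rightAttached ,
      entry≡edgesOf (just (s , e)) (λ t t<k → trans (onMiddle t t<k) (sym (middleBits-inInterval s e t t<k)))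
      where
      Vstart : InV (suc (suc s))
      Vstart = proj₁ (pathBit-ends (suc (suc s))
                                   (trans (onMiddle s (≤-<-trans s≤e e<k)) (inInterval≡true ≤-refl s≤e)))
      Vend : InV (suc (suc e))
      Vend = proj₁ (pathBit-ends (suc (suc e)) (trans (onMiddle e e<k) (inInterval≡true s≤e ≤-refl)))
      2+e<n : suc (suc e) < n
      2+e<n = s≤s (s≤s (s≤s (≤-trans (<⇒≤ e<k) (m≤n+m k 2))))
      start≡0 : ∀ s′ → s′ ≤ e → (∀ t → t < k → middlePath t ≡ inInterval s′ e t) →
        anyEdge leftTriangle ≡ true → s′ ≡ 0
      start≡0 zero _ _ _ = refl
      start≡0 (suc t) 1+t≤e onMiddle′ nonEmpty =
        let (u , u≤1 , Vu) = leftVertex nonEmpty in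
        ⊥-elim (separated (suc (suc t))
                  (trans (onMiddle′ t (<-trans ≤-refl 1+t<k)) (inInterval-below (suc t) e t ≤-refl))
                  (inj₂ (s≤s (s≤s z≤n))) (inj₂ (s≤s (s≤s (<⇒≤ 1+t<k))))
                  u (suc (suc (suc t))) (≤-trans u≤1 (s≤s z≤n)) ≤-refl (<-≤-trans (s≤s (s≤s (s≤s 1+t≤e))) 2+e<n) Vu
                  (proj₁ (pathBit-ends (suc (suc (suc t)))
                                       (trans (onMiddle′ (suc t) 1+t<k) (inInterval≡true ≤-refl 1+t≤e)))))
        where
        1+t<k = ≤-<-trans 1+t≤e e<k
      leftAttached : LeftAttached leftTriangle s
      leftAttached with true-or-false (anyEdge leftTriangle) | true-or-false (atJoint leftTriangle)
      ... | inj₂ empty | _ = inj₁ (anyEdge≡false⇒noEdges _ empty)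
      ... | inj₁ nonEmpty | inj₁ joint = inj₂ (start≡0 s s≤e onMiddle nonEmpty , joint)
      ... | inj₁ nonEmpty | inj₂ notJoint =
        ⊥-elim (separated 1 (∨-conicalˡ (pathBits 1) leftChordBit notJoint)
                  (inj₁ (∨-conicalʳ (pathBits 1) leftChordBit notJoint))
                  (inj₂ (s≤s (s≤s z≤n))) 0 (suc (suc s)) z≤n (s≤s (s≤s z≤n)) (≤-<-trans (s≤s (s≤s s≤e)) 2+e<n)
                  (proj₁ (pathBit-ends 0 (farOnly leftTriangle nonEmpty notJoint))) Vstart)
      end≡k′ : anyEdge rightTriangle ≡ true → e ≡ k'
      end≡k′ nonEmpty with m≤n⇒m<n∨m≡n (≤-pred e<k)
      ... | inj₂ e≡k′ = e≡k′
      ... | inj₁ e<k′ =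
        let (v , K3≤v , v<n , Vv) = rightVertex nonEmpty in
        ⊥-elim (separated (suc (suc (suc e)))
                  (trans (onMiddle (suc e) (s≤s e<k′)) (inInterval-above s e (suc e) ≤-refl))
                  (inj₂ (s≤s (s≤s z≤n))) (inj₂ (s≤s (s≤s (s≤s e<k′))))
                  (suc (suc e)) v (n≤1+n _) (<-≤-trans (s≤s (s≤s (s≤s e<k′))) (≤-trans (n≤1+n K2) K3≤v)) v<n Vend Vv)
      rightAttached : RightAttached rightTriangle e
      rightAttached with true-or-false (anyEdge rightTriangle) | true-or-false (atJoint rightTriangle)
      ... | inj₂ empty | _ = inj₁ (anyEdge≡false⇒noEdges _ empty)
      ... | inj₁ nonEmpty | inj₁ joint = inj₂ (end≡k′ nonEmpty , joint)
      ... | inj₁ nonEmpty | inj₂ notJoint =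
        ⊥-elim (separated K2 (∨-conicalˡ (pathBits K2) rightChordBit notJoint) (inj₂ (s≤s (s≤s z≤n)))
                  (inj₁ (∨-conicalʳ (pathBits K2) rightChordBit notJoint))
                  (suc (suc e)) K4 (s≤s (s≤s (<⇒≤ e<k))) (<-trans (n<1+n K2) (n<1+n K3)) ≤-refl
                  Vend (proj₂ (pathBit-ends K3 (farOnly rightTriangle nonEmpty notJoint))))

    shapeOf : ∀ a b → entry M a b ≡ true → MatchingShape
    shapeOf a b Mab with noGap⇒allFalse⊎interval k middlePath noGap-middle
    ... | inj₁ noMiddle = shapeWithoutMiddle a b Mab noMiddle
    ... | inj₂ ((s , e) , I , onMiddle) = shapeWithMiddle s e I onMiddle

  enumeration : Enumeration (c33EdgeSets k)
  enumeration = record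
    { Index = Shape
    ; Valid = ValidShape
    ; count = HasCount-ValidShape
    ; edgeSet = edgesOf
    ; isEdgeSet = edgesOf-isEdgeSet
    ; nonEmpty = edgesOf-nonEmpty
    ; rooted = edgesOf-rooted
    ; injective = edgesOf-injective
    ; complete = λ V M C → shapeOf C
    }

  coreIndex-C33 : CoreIndexIs (C33 n) (n + c33EdgeSets k)
  coreIndex-C33 = coreIndex enumeration

-- Comparing the counts

2*triangle : ∀ m → 2 * triangle m ≡ m * suc m
2*triangle zero = refl
2*triangle (suc m) = begin
  2 * (triangle m + suc m)        ≡⟨ *-distribˡ-+ 2 (triangle m) (suc m) ⟩
  2 * triangle m + 2 * suc m      ≡⟨ cong (_+ 2 * suc m) (2*triangle m) ⟩
  m * suc m + 2 * suc m           ≡⟨ expand m ⟩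
  suc m * suc (suc m)             ∎
  where
  open ≡-Reasoning
  expand : ∀ m → m * suc m + 2 * suc m ≡ suc m * suc (suc m)
  expand = solve-∀

2*cycleEdgeSets : ∀ m → 2 * cycleEdgeSets m ≡ 2 * (m * suc m) + 2
2*cycleEdgeSets m = begin
  2 * (triangle m + (triangle m + 1))  ≡⟨ distribute (triangle m) ⟩
  2 * (2 * triangle m) + 2              ≡⟨ cong (λ x → 2 * x + 2) (2*triangle m) ⟩
  2 * (m * suc m) + 2                   ∎
  where
  open ≡-Reasoning
  distribute : ∀ t → 2 * (t + (t + 1)) ≡ 2 * (2 * t) + 2
  distribute = solve-∀

2*c33EdgeSets : ∀ k → 2 * c33EdgeSets k ≡ 100 + k * suc k + 24 * k
2*c33EdgeSets k = begin
  2 * c33EdgeSets k                      ≡⟨ distribute (triangle k) k ⟩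
  100 + 2 * triangle k + 24 * k          ≡⟨ cong (λ x → 100 + x + 24 * k) (2*triangle k) ⟩
  100 + k * suc k + 24 * k               ∎
  where
  open ≡-Reasoning
  distribute : ∀ t k → 2 * (7 + (7 + (t + (6 * k + (6 * k + 6 * 6))))) ≡ 100 + 2 * t + 24 * k
  distribute = solve-∀

c33EdgeSets≤cycleEdgeSets : ∀ j → c33EdgeSets (12 + j) ≤ cycleEdgeSets (16 + j)
c33EdgeSets≤cycleEdgeSets j = *-cancelˡ-≤ 2 (begin
  2 * c33EdgeSets (12 + j)                                              ≡⟨ 2*c33EdgeSets (12 + j) ⟩
  100 + (12 + j) * (13 + j) + 24 * (12 + j)                             ≤⟨ m≤m+n _ (j * (17 + j) + 2) ⟩
  100 + (12 + j) * (13 + j) + 24 * (12 + j) + (j * (17 + j) + 2)        ≡⟨ expand j ⟩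
  2 * ((16 + j) * (17 + j)) + 2                                         ≡⟨ 2*cycleEdgeSets (16 + j) ⟨
  2 * cycleEdgeSets (16 + j)                                            ∎)
  where
  open ≤-Reasoning
  expand : ∀ j → 100 + (12 + j) * (13 + j) + 24 * (12 + j) + (j * (17 + j) + 2) ≡ 2 * ((16 + j) * (17 + j)) + 2
  expand = solve-∀

cycleEdgeSets<c33EdgeSets : ∀ j → j ≤ 10 → cycleEdgeSets (5 + j) < c33EdgeSets (1 + j)
cycleEdgeSets<c33EdgeSets 0 _ = toWitness {a? = cycleEdgeSets 5 <? c33EdgeSets 1} tt
cycleEdgeSets<c33EdgeSets 1 _ = toWitness {a? = cycleEdgeSets 6 <? c33EdgeSets 2} tt
cycleEdgeSets<c33EdgeSets 2 _ = toWitness {a? = cycleEdgeSets 7 <? c33EdgeSets 3} tt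
cycleEdgeSets<c33EdgeSets 3 _ = toWitness {a? = cycleEdgeSets 8 <? c33EdgeSets 4} tt
cycleEdgeSets<c33EdgeSets 4 _ = toWitness {a? = cycleEdgeSets 9 <? c33EdgeSets 5} tt
cycleEdgeSets<c33EdgeSets 5 _ = toWitness {a? = cycleEdgeSets 10 <? c33EdgeSets 6} tt
cycleEdgeSets<c33EdgeSets 6 _ = toWitness {a? = cycleEdgeSets 11 <? c33EdgeSets 7} tt
cycleEdgeSets<c33EdgeSets 7 _ = toWitness {a? = cycleEdgeSets 12 <? c33EdgeSets 8} tt
cycleEdgeSets<c33EdgeSets 8 _ = toWitness {a? = cycleEdgeSets 13 <? c33EdgeSets 9} tt
cycleEdgeSets<c33EdgeSets 9 _ = toWitness {a? = cycleEdgeSets 14 <? c33EdgeSets 10} tt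
cycleEdgeSets<c33EdgeSets 10 _ = toWitness {a? = cycleEdgeSets 15 <? c33EdgeSets 11} tt
cycleEdgeSets<c33EdgeSets (suc (suc (suc (suc (suc (suc (suc (suc (suc (suc (suc _))))))))))) (s≤s (s≤s (s≤s (s≤s (s≤s (s≤s (s≤s (s≤s (s≤s (s≤s ()))))))))))

lemma5p7-shifted : ∀ j → Σ ℕ λ a → Σ ℕ λ b →
  CoreIndexIs (Cycle (6 + j)) a × CoreIndexIs (C33 (6 + j)) b × ((a < b) ⇔ (6 + j ≤ 16))
lemma5p7-shifted j =
  6 + j + cycleEdgeSets (5 + j) , 6 + j + c33EdgeSets (1 + j) ,
  CycleCount.coreIndex-Cycle (5 + j) (s≤s (s≤s z≤n)) , C33Count.coreIndex-C33 j ,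
  mk⇔ to from
  where
  to : 6 + j + cycleEdgeSets (5 + j) < 6 + j + c33EdgeSets (1 + j) → 6 + j ≤ 16
  to lt with j ≤? 10
  ... | yes j≤10 = +-monoʳ-≤ 6 j≤10
  ... | no j≰10 = ⊥-elim (<⇒≱ (+-cancelˡ-< (6 + j) _ _ lt)
                              (subst (λ i → c33EdgeSets (1 + i) ≤ cycleEdgeSets (5 + i)) (m+[n∸m]≡n (≰⇒> j≰10))
                                     (c33EdgeSets≤cycleEdgeSets (j ∸ 11))))
  from : 6 + j ≤ 16 → 6 + j + cycleEdgeSets (5 + j) < 6 + j + c33EdgeSets (1 + j)
  from 6+j≤16 = +-monoʳ-< (6 + j) (cycleEdgeSets<c33EdgeSets j (+-cancelˡ-≤ 6 j 10 6+j≤16))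

lemma5p7 : (n : ℕ) → 6 ≤ n →
    Σ ℕ λ a → Σ ℕ λ b →
      CoreIndexIs (Cycle n) a × CoreIndexIs (C33 n) b × ((a < b) ⇔ (n ≤ 16))
lemma5p7 n 6≤n = subst Claim (m+[n∸m]≡n 6≤n) (lemma5p7-shifted (n ∸ 6))
  where
  Claim : ℕ → Set
  Claim n = Σ ℕ λ a → Σ ℕ λ b → CoreIndexIs (Cycle n) a × CoreIndexIs (C33 n) b × ((a < b) ⇔ (n ≤ 16))
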